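{- Let $\Psi:\mathbb{Q}[x]\to\mathbb{Q}$ be the linear form with $\Psi(x^n)=B_n$, where $\frac{t}{e^t-1}=\sum_{n\ge0}B_n\frac{t^n}{n!}$, and let $\mathscr{R}^+_n=\Psi\!\left(\binom{x+2}{2}^n\right)$ for $n\ge0$. Let $(R_n)_{n\ge0}$ be the Racah polynomials with parameters $(\alpha,\beta,\gamma,\delta)=(-1/2,2,1,-1)$, and let $\Lambda$ be the unique linear form on $\mathbb{Q}[y]$ with $\Lambda(1)=1$ and $\Lambda(R_n)=0$ for all $n>0$. Then $\Lambda(y^n)=2^n\mathscr{R}^+_{n+2}/\mathscr{R}^+_2$ for all $n\ge 0$, i.e. the numbers $(2^n\mathscr{R}^+_{n+2}/\mathscr{R}^+_2)_{n\ge0}$ are the moments of this family of orthogonal polynomials.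
   Context: For parameters $\alpha,\beta,\gamma,\delta$, the Racah polynomial $R_n$ is the polynomial of degree $n$ in a variable $y$ such that, with $\lambda(x)=x(x+\gamma+\delta+1)$, $$R_n(\lambda(x))=\sum_{k=0}^{n}\frac{(-n)_k(n+\alpha+\beta+1)_k(-x)_k(x+\gamma+\delta+1)_k}{(\alpha+1)_k(\beta+\delta+1)_k(\gamma+1)_k\,k!},$$ where $(a)_k=a(a+1)\cdots(a+k-1)$ is the Pochhammer symbol. The "moments" of the family are $\Lambda(y^n)$, $n\ge 0$. -}

module Defs where

open import Data.Nat as ℕ using (ℕ; zero; suc)
open import Data.Nat.Combinatorics using (_C_)
open import Data.Integer as ℤ using (+_)
open import Data.Bool using (true; false)
open import Relation.Nullary using (yes; no)
open import Data.List using (List; []; _∷_)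
open import Data.Rational as ℚ using (ℚ; 0ℚ; 1ℚ; _+_; _*_; -_; _/_; _÷_)

ι : ℕ → ℚ
ι n = (+ n) / 1

sumTo : ℕ → (ℕ → ℚ) → ℚ
sumTo zero    f = 0ℚ
sumTo (suc n) f = sumTo n f + f n

poch : ℚ → ℕ → ℚ
poch a zero    = 1ℚ
poch a (suc k) = poch a k * (a + ι k)

-- Bernoulli numbers, t/(e^t - 1) = Σ B_n t^n/n!  (so B_1 = -1/2).
-- Comparing coefficients of t^n in (Σ B_k t^k/k!)((e^t-1)/t) = 1 gives
-- B_0 = 1 and Σ_{k=0}^{n} C(n+1,k) B_k = 0 for n ≥ 1, i.e.
-- B_n = -(1/(n+1)) Σ_{k<n} C(n+1,k) B_k.

-- bernUpTo n k = B_k for k ≤ n (computed list-free by recursion on n)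
bernUpTo : ℕ → ℕ → ℚ
bernUpTo zero    k = 1ℚ
bernUpTo (suc n) k with k ℕ.≤ᵇ n
... | true  = bernUpTo n k
... | false = - ((+ 1 / suc (suc n)) * sumTo (suc n) (λ j → ι (suc (suc n) C j) * bernUpTo n j))

bernoulli : ℕ → ℚ
bernoulli n = bernUpTo n n

-- Polynomials over ℚ as coefficient lists, lowest degree first.

Poly : Set
Poly = List ℚ

pconst : ℚ → Poly
pconst c = c ∷ []

pX : Poly
pX = 0ℚ ∷ 1ℚ ∷ []

padd : Poly → Poly → Poly
padd []       q        = q
padd (a ∷ p)  []       = a ∷ p
padd (a ∷ p)  (b ∷ q)  = (a + b) ∷ padd p q

pscale : ℚ → Poly → Poly
pscale c []      = []
pscale c (a ∷ p) = (c * a) ∷ pscale c p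

pmul : Poly → Poly → Poly
pmul []      q = []
pmul (a ∷ p) q = padd (pscale a q) (0ℚ ∷ pmul p q)

ppow : Poly → ℕ → Poly
ppow p zero    = pconst 1ℚ
ppow p (suc n) = pmul (ppow p n) p

psumTo : ℕ → (ℕ → Poly) → Poly
psumTo zero    f = []
psumTo (suc n) f = padd (psumTo n f) (f n)

-- The linear form on ℚ[x] sending x^i to m i:  Σ_i p_i m_i.
-- (Every linear form on ℚ[x] is of this form for a unique m.)
applyForm : (ℕ → ℚ) → Poly → ℚ
applyForm m p = go 0 p
  where
  go : ℕ → Poly → ℚ
  go i []      = 0ℚ
  go i (a ∷ p) = a * m i + go (suc i) p

Ψ : Poly → ℚ
Ψ = applyForm bernoulli

-- binom(x+2,2) = (x+2)(x+1)/2 = 1 + (3/2) x + (1/2) x²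
binomX+2-2 : Poly
binomX+2-2 = 1ℚ ∷ (+ 3 / 2) ∷ (+ 1 / 2) ∷ []

ℛ⁺ : ℕ → ℚ
ℛ⁺ n = Ψ (ppow binomX+2-2 n)

-- With λ(x) = x(x+γ+δ+1) one has, for each j,
--   (j - x)(x + γ+δ+1 + j) = j(j+γ+δ+1) - λ(x),
-- so (-x)_k (x+γ+δ+1)_k = P_k(λ(x)) with P_k(y) = Π_{j<k} (j(j+γ+δ+1) - y).

racahFactor : ℚ → ℚ → ℕ → Poly
racahFactor γ δ zero    = pconst 1ℚ
racahFactor γ δ (suc k) =
  pmul (racahFactor γ δ k) (ι k * (ι k + γ + δ + 1ℚ) ∷ - 1ℚ ∷ [])

racahCoeff : ℚ → ℚ → ℚ → ℚ → ℕ → ℕ → ℚ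
racahCoeff α β γ δ n k =
  (poch (- ι n) k * poch (ι n + α + β + 1ℚ) k)
  ÷' (poch (α + 1ℚ) k * poch (β + δ + 1ℚ) k * poch (γ + 1ℚ) k * poch 1ℚ k)
  where
  -- division, with the convention p ÷' 0 = 0 (never used for the
  -- parameters below, where all denominators are nonzero)
  _÷'_ : ℚ → ℚ → ℚ
  p ÷' q with q ℚ.≟ 0ℚ
  ... | yes _  = 0ℚ
  ... | no q≢0 = ℚ._÷_ p q {{ℚ.≢-nonZero q≢0}}

racah : ℚ → ℚ → ℚ → ℚ → ℕ → Poly
racah α β γ δ n =
  psumTo (suc n) (λ k → pscale (racahCoeff α β γ δ n k) (racahFactor γ δ k))

Rₙ : ℕ → Poly
Rₙ = racah (ℚ.- (+ 1 / 2)) (ι 2) 1ℚ (ℚ.- 1ℚ)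

-- ℛ⁺_2 = 1/30 ≠ 0

instance
  ℛ⁺₂-nonZero : ℚ.NonZero (ℛ⁺ 2)
  ℛ⁺₂-nonZero = _

claimedMoment : ℕ → ℚ
claimedMoment n = (ι (2 ℕ.^ n) * ℛ⁺ (n ℕ.+ 2)) ÷ ℛ⁺ 2

{-# OPTIONS --safe #-}
-- The claimed moments are (15/2) Ψ(u^{n+2}) with u = (x+1)(x+2), i.e. Λ(p(y)) = (15/2) Ψ(u² p(u)).
-- The Racah polynomials are combinations of P_k(y) = ∏_{j<k} (j(j+1) − y), and P_k(u(x)) is
-- (−1)^k h_k(x+1) with h_k(x) = ∏_{j<k} (x+j+1)(x−j). The translation rule Ψ(p(x+1)) = Ψ(p) + p′(0)
-- (the Bernoulli recurrence) turns Λ(P_k) into a combination of Ψ(h_k), Ψ(h_{k+1}), Ψ(h_{k+2}) and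
-- also gives (2j+1) Ψ(h_j) = (−1)^j j!²; hence Λ(P_k) = 15 (k+1)!² / ((2k+1)(2k+3)(2k+5)).
-- Then Λ(R_N) = Σ_k (−N)_k (N+5/2)_k / (k! (7/2)_k), a telescoping sum that vanishes for N ≥ 1.
-- Conversely R_N is triangular in the P_k, so these conditions determine every moment.
module Submission where

open import Defs
open import Data.Nat as ℕ using (ℕ; zero; suc; z≤n)
import Data.Nat.Properties as ℕP
open import Data.Nat.Combinatorics using (_C_; nCk+nC[k+1]≡[n+1]C[k+1]; nCn≡1; nC1≡n; nCk≡nC[n∸k])
open import Data.Nat.Combinatorics.Specification using (k>n⇒nCk≡0)
open import Data.Nat.Coprimality using (1-coprimeTo) renaming (sym to coprime-sym)
open import Data.Nat.GeneralisedArithmetic using (iterate)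
open import Data.Nat.Induction using (<-rec)
open import Data.Bool using (true; false; T)
open import Data.Unit using (tt)
open import Data.Empty using (⊥-elim)
open import Data.Sum using (inj₁; inj₂)
open import Data.Product using (_×_; _,_)
open import Data.List using ([]; _∷_)
import Data.Integer as ℤ
import Data.Integer.Properties as ℤP
open import Data.Rational as ℚ using (ℚ; 0ℚ; 1ℚ; _+_; _*_; -_; 1/_; Positive; toℚᵘ)
import Data.Rational.Properties as ℚP
import Data.Rational.Unnormalised as ℚᵘ
import Data.Rational.Unnormalised.Properties as ℚᵘP
import Tactic.RingSolver.Core.AlmostCommutativeRing as ACR
open import Tactic.RingSolver using (solve-∀)
open import Relation.Nullary using (yes; no)
open import Relation.Nullary.Decidable using (dec⇒maybe)
open import Relation.Binary.PropositionalEquality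
open import Function using (_∘_; id)
open import Function.Bundles using (_⇔_; mk⇔)

ℚ-ring : ACR.AlmostCommutativeRing _ _
ℚ-ring = ACR.fromCommutativeRing ℚP.+-*-commutativeRing (λ x → dec⇒maybe (0ℚ ℚP.≟ x))

toℚᵘ-ι : ∀ n → toℚᵘ (ι n) ≡ ℚᵘ.mkℚᵘ (ℤ.+ n) 0
toℚᵘ-ι n rewrite ℚP.normalize-coprime (coprime-sym (1-coprimeTo n)) = refl

ι-homo-+ : ∀ m n → ι (m ℕ.+ n) ≡ ι m + ι n
ι-homo-+ m n = ℚP.toℚᵘ-injective (begin
  toℚᵘ (ι (m ℕ.+ n))                                    ≡⟨ toℚᵘ-ι (m ℕ.+ n) ⟩
  ℚᵘ.mkℚᵘ (ℤ.+ (m ℕ.+ n)) 0                              ≈⟨ ℚᵘ.*≡* (cong (ℤ._* ℤ.+ 1) (trans (ℤP.pos-+ m n)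
                                                           (sym (cong₂ ℤ._+_ (ℤP.*-identityʳ (ℤ.+ m)) (ℤP.*-identityʳ (ℤ.+ n)))))) ⟩
  ℚᵘ.mkℚᵘ (ℤ.+ m) 0 ℚᵘ.+ ℚᵘ.mkℚᵘ (ℤ.+ n) 0               ≡⟨ sym (cong₂ ℚᵘ._+_ (toℚᵘ-ι m) (toℚᵘ-ι n)) ⟩
  toℚᵘ (ι m) ℚᵘ.+ toℚᵘ (ι n)                            ≈⟨ ℚᵘP.≃-sym (ℚP.toℚᵘ-homo-+ (ι m) (ι n)) ⟩
  toℚᵘ (ι m + ι n)                                      ∎)
  where open ℚᵘP.≃-Reasoning

ι-homo-* : ∀ m n → ι (m ℕ.* n) ≡ ι m * ι n
ι-homo-* m n = ℚP.toℚᵘ-injective (begin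
  toℚᵘ (ι (m ℕ.* n))                          ≡⟨ toℚᵘ-ι (m ℕ.* n) ⟩
  ℚᵘ.mkℚᵘ (ℤ.+ (m ℕ.* n)) 0                    ≈⟨ ℚᵘ.*≡* (cong (ℤ._* ℤ.+ 1) (ℤP.pos-* m n)) ⟩
  ℚᵘ.mkℚᵘ (ℤ.+ m) 0 ℚᵘ.* ℚᵘ.mkℚᵘ (ℤ.+ n) 0     ≡⟨ sym (cong₂ ℚᵘ._*_ (toℚᵘ-ι m) (toℚᵘ-ι n)) ⟩
  toℚᵘ (ι m) ℚᵘ.* toℚᵘ (ι n)                  ≈⟨ ℚᵘP.≃-sym (ℚP.toℚᵘ-homo-* (ι m) (ι n)) ⟩
  toℚᵘ (ι m * ι n)                            ∎)
  where open ℚᵘP.≃-Reasoning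

ι-suc : ∀ n → ι (suc n) ≡ ι n + 1ℚ
ι-suc n = trans (cong ι (ℕP.+-comm 1 n)) (ι-homo-+ n 1)

ι-*-reciprocal : ∀ n → ι (suc n) * (ℤ.+ 1 ℚ./ suc n) ≡ 1ℚ
ι-*-reciprocal n = ℚP.toℚᵘ-injective (begin
  toℚᵘ (ι (suc n) * (ℤ.+ 1 ℚ./ suc n))                  ≈⟨ ℚP.toℚᵘ-homo-* (ι (suc n)) _ ⟩
  toℚᵘ (ι (suc n)) ℚᵘ.* toℚᵘ (ℤ.+ 1 ℚ./ suc n)          ≡⟨ cong₂ ℚᵘ._*_ (toℚᵘ-ι (suc n)) reciprocal ⟩
  ℚᵘ.mkℚᵘ (ℤ.+ suc n) 0 ℚᵘ.* ℚᵘ.mkℚᵘ (ℤ.+ 1) n           ≈⟨ ℚᵘ.*≡* (trans (ℤP.*-identityʳ _) (sym (trans (ℤP.*-identityˡ _)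
                                                          (cong ℤ.+_ (trans (ℕP.*-identityˡ (suc n)) (sym (ℕP.*-identityʳ (suc n)))))))) ⟩
  toℚᵘ 1ℚ                                              ∎)
  where
  open ℚᵘP.≃-Reasoning
  reciprocal : toℚᵘ (ℤ.+ 1 ℚ./ suc n) ≡ ℚᵘ.mkℚᵘ (ℤ.+ 1) n
  reciprocal rewrite ℚP.normalize-coprime {1} {n} (1-coprimeTo (suc n)) = refl

ι-nonNeg : ∀ n → ℚ.NonNegative (ι n)
ι-nonNeg n = ℚP.normalize-nonNeg n 1

ι-pos : ∀ n → Positive (ι (suc n))
ι-pos n = ℚP.normalize-pos (suc n) 1

pos⇒≢0 : ∀ {p} → Positive p → p ≢ 0ℚ
pos⇒≢0 () refl

*-cancelʳ : ∀ {a b c} → c ≢ 0ℚ → a * c ≡ b * c → a ≡ b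
*-cancelʳ {a} {b} {c} c≢0 ac≡bc = begin
  a                ≡⟨ undo a ⟩
  a * c * 1/ c     ≡⟨ cong (_* 1/ c) ac≡bc ⟩
  b * c * 1/ c     ≡⟨ sym (undo b) ⟩
  b                ∎
  where
  open ≡-Reasoning
  instance
    c-nonZero : ℚ.NonZero c
    c-nonZero = ℚ.≢-nonZero c≢0
  undo : ∀ x → x ≡ x * c * 1/ c
  undo x = sym (trans (ℚP.*-assoc x c (1/ c)) (trans (cong (x *_) (ℚP.*-inverseʳ c)) (ℚP.*-identityʳ x)))

*-≢0 : ∀ {p q} → p ≢ 0ℚ → q ≢ 0ℚ → p * q ≢ 0ℚ
*-≢0 {p} {q} p≢0 q≢0 pq≡0 = p≢0 (*-cancelʳ q≢0 (trans pq≡0 (sym (ℚP.*-zeroˡ q))))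

-- Linear forms on ℚ[x]

Form : Set
Form = ℕ → ℚ

infixl 6 _+ᶠ_
infixl 7 _·ᶠ_

_+ᶠ_ : Form → Form → Form
(μ +ᶠ ν) i = μ i + ν i

_·ᶠ_ : ℚ → Form → Form
(a ·ᶠ μ) i = a * μ i

0ᶠ : Form
0ᶠ _ = 0ℚ

evalForm : Form → Poly → ℚ
evalForm μ []      = 0ℚ
evalForm μ (a ∷ p) = a * μ 0 + evalForm (μ ∘ suc) p

-- `applyForm` is defined through a local helper that cannot be named from
-- outside Defs; it is recovered by unification, with-abstracting the
-- arguments so that the constraint is a pattern.
mutual
  applyForm-go : Form → Poly → ℕ → Poly → ℚ
  applyForm-go = _

  applyForm-unfold : ∀ m a q → applyForm m (a ∷ q) ≡ a * m 0 + applyForm-go m (a ∷ q) 1 q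
  applyForm-unfold m a q with a ∷ q | 1
  ... | p | i = refl

evalForm-cong : ∀ {μ ν} → μ ≗ ν → ∀ p → evalForm μ p ≡ evalForm ν p
evalForm-cong μ≗ν []      = refl
evalForm-cong μ≗ν (a ∷ p) = cong₂ _+_ (cong (a *_) (μ≗ν 0)) (evalForm-cong (μ≗ν ∘ suc) p)

applyForm≡evalForm : ∀ m p → applyForm m p ≡ evalForm m p
applyForm≡evalForm m []      = refl
applyForm≡evalForm m (a ∷ q) = trans (applyForm-unfold m a q) (cong (a * m 0 +_) (go-from 1 q))
  where
  go-from : ∀ i r → applyForm-go m (a ∷ q) i r ≡ evalForm (λ j → m (i ℕ.+ j)) r
  go-from i []      = refl
  go-from i (b ∷ r) = cong₂ _+_ (cong (λ k → b * m k) (sym (ℕP.+-identityʳ i)))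
    (trans (go-from (suc i) r) (evalForm-cong (λ j → cong m (sym (ℕP.+-suc i j))) r))

evalForm-+ᶠ : ∀ μ ν p → evalForm (μ +ᶠ ν) p ≡ evalForm μ p + evalForm ν p
evalForm-+ᶠ μ ν []      = sym (ℚP.+-identityʳ 0ℚ)
evalForm-+ᶠ μ ν (a ∷ p) = trans (cong (a * (μ 0 + ν 0) +_) (evalForm-+ᶠ (μ ∘ suc) (ν ∘ suc) p))
  (distrib a (μ 0) (ν 0) _ _)
  where
  distrib : ∀ a x y u v → a * (x + y) + (u + v) ≡ (a * x + u) + (a * y + v)
  distrib = solve-∀ ℚ-ring

evalForm-·ᶠ : ∀ c μ p → evalForm (c ·ᶠ μ) p ≡ c * evalForm μ p
evalForm-·ᶠ c μ []      = sym (ℚP.*-zeroʳ c)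
evalForm-·ᶠ c μ (a ∷ p) = trans (cong (a * (c * μ 0) +_) (evalForm-·ᶠ c (μ ∘ suc) p)) (distrib c a (μ 0) _)
  where
  distrib : ∀ c a x u → a * (c * x) + c * u ≡ c * (a * x + u)
  distrib = solve-∀ ℚ-ring

evalForm-padd : ∀ μ p q → evalForm μ (padd p q) ≡ evalForm μ p + evalForm μ q
evalForm-padd μ []      q       = sym (ℚP.+-identityˡ _)
evalForm-padd μ (a ∷ p) []      = sym (ℚP.+-identityʳ _)
evalForm-padd μ (a ∷ p) (b ∷ q) = trans (cong ((a + b) * μ 0 +_) (evalForm-padd (μ ∘ suc) p q))
  (distrib a b (μ 0) _ _)
  where
  distrib : ∀ a b x u v → (a + b) * x + (u + v) ≡ (a * x + u) + (b * x + v)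
  distrib = solve-∀ ℚ-ring

evalForm-pscale : ∀ μ c p → evalForm μ (pscale c p) ≡ c * evalForm μ p
evalForm-pscale μ c []      = sym (ℚP.*-zeroʳ c)
evalForm-pscale μ c (a ∷ p) = trans (cong (c * a * μ 0 +_) (evalForm-pscale (μ ∘ suc) c p))
  (distrib c a (μ 0) _)
  where
  distrib : ∀ c a x u → c * a * x + c * u ≡ c * (a * x + u)
  distrib = solve-∀ ℚ-ring

evalForm-pconst : ∀ μ c → evalForm μ (pconst c) ≡ c * μ 0
evalForm-pconst μ c = ℚP.+-identityʳ (c * μ 0)

evalForm-psumTo : ∀ μ n f → evalForm μ (psumTo n f) ≡ sumTo n (λ k → evalForm μ (f k))
evalForm-psumTo μ zero    f = refl
evalForm-psumTo μ (suc n) f =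
  trans (evalForm-padd μ (psumTo n f) (f n)) (cong (_+ evalForm μ (f n)) (evalForm-psumTo μ n f))

-- The form p ↦ μ (p q).
infixl 7 _⋆_
_⋆_ : Form → Poly → Form
(μ ⋆ q) i = evalForm (λ j → μ (i ℕ.+ j)) q

evalForm-pmul : ∀ μ p q → evalForm μ (pmul p q) ≡ evalForm (μ ⋆ q) p
evalForm-pmul μ []      q = refl
evalForm-pmul μ (a ∷ p) q = begin
  evalForm μ (padd (pscale a q) (0ℚ ∷ pmul p q))
    ≡⟨ evalForm-padd μ (pscale a q) (0ℚ ∷ pmul p q) ⟩
  evalForm μ (pscale a q) + (0ℚ * μ 0 + evalForm (μ ∘ suc) (pmul p q))
    ≡⟨ cong₂ (λ u v → u + (0ℚ * μ 0 + v)) (evalForm-pscale μ a q) (evalForm-pmul (μ ∘ suc) p q) ⟩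
  a * evalForm μ q + (0ℚ * μ 0 + evalForm ((μ ∘ suc) ⋆ q) p)
    ≡⟨ drop-zero (a * evalForm μ q) (μ 0) _ ⟩
  a * evalForm μ q + evalForm ((μ ∘ suc) ⋆ q) p ∎
  where
  open ≡-Reasoning
  drop-zero : ∀ u x v → u + (0ℚ * x + v) ≡ u + v
  drop-zero = solve-∀ ℚ-ring

⋆-linear : ∀ μ a b → μ ⋆ (a ∷ b ∷ []) ≗ a ·ᶠ μ +ᶠ b ·ᶠ (μ ∘ suc)
⋆-linear μ a b i = begin
  a * μ (i ℕ.+ 0) + (b * μ (i ℕ.+ 1) + 0ℚ)  ≡⟨ cong₂ (λ j k → a * μ j + (b * μ k + 0ℚ)) (ℕP.+-identityʳ i) (ℕP.+-comm i 1) ⟩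
  a * μ i + (b * μ (suc i) + 0ℚ)           ≡⟨ cong (a * μ i +_) (ℚP.+-identityʳ _) ⟩
  a * μ i + b * μ (suc i)                  ∎
  where open ≡-Reasoning

⋆-quadratic : ∀ μ a b c → μ ⋆ (a ∷ b ∷ c ∷ []) ≗ a ·ᶠ μ +ᶠ b ·ᶠ (μ ∘ suc) +ᶠ c ·ᶠ (μ ∘ suc ∘ suc)
⋆-quadratic μ a b c i = begin
  a * μ (i ℕ.+ 0) + (b * μ (i ℕ.+ 1) + (c * μ (i ℕ.+ 2) + 0ℚ))
    ≡⟨ cong₂ (λ j k → a * μ j + (b * μ k + (c * μ (i ℕ.+ 2) + 0ℚ))) (ℕP.+-identityʳ i) (ℕP.+-comm i 1) ⟩
  a * μ i + (b * μ (suc i) + (c * μ (i ℕ.+ 2) + 0ℚ))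
    ≡⟨ cong (λ j → a * μ i + (b * μ (suc i) + (c * μ j + 0ℚ))) (ℕP.+-comm i 2) ⟩
  a * μ i + (b * μ (suc i) + (c * μ (suc (suc i)) + 0ℚ))
    ≡⟨ reassoc (a * μ i) (b * μ (suc i)) (c * μ (suc (suc i))) ⟩
  a * μ i + b * μ (suc i) + c * μ (suc (suc i)) ∎
  where
  open ≡-Reasoning
  reassoc : ∀ x y z → x + (y + (z + 0ℚ)) ≡ x + y + z
  reassoc = solve-∀ ℚ-ring

record IsLinear (O : Form → Form) : Set where
  field
    cong-≗  : ∀ {μ ν} → μ ≗ ν → O μ ≗ O ν
    +ᶠ-homo : ∀ μ ν → O (μ +ᶠ ν) ≗ O μ +ᶠ O ν
    ·ᶠ-homo : ∀ a μ → O (a ·ᶠ μ) ≗ a ·ᶠ O μ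

  0ᶠ-homo : O 0ᶠ ≗ 0ᶠ
  0ᶠ-homo i = trans (·ᶠ-homo 0ℚ 0ᶠ i) (ℚP.*-zeroˡ (O 0ᶠ i))

open IsLinear

id-linear : IsLinear id
id-linear = record { cong-≗ = id ; +ᶠ-homo = λ _ _ _ → refl ; ·ᶠ-homo = λ _ _ _ → refl }

∘-linear : ∀ {O P} → IsLinear O → IsLinear P → IsLinear (O ∘ P)
∘-linear {O} {P} O-lin P-lin = record
  { cong-≗  = cong-≗ O-lin ∘ cong-≗ P-lin
  ; +ᶠ-homo = λ μ ν i → trans (cong-≗ O-lin (+ᶠ-homo P-lin μ ν) i) (+ᶠ-homo O-lin (P μ) (P ν) i)
  ; ·ᶠ-homo = λ a μ i → trans (cong-≗ O-lin (·ᶠ-homo P-lin a μ) i) (·ᶠ-homo O-lin a (P μ) i)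
  }

iterate-linear : ∀ {O} → IsLinear O → ∀ n → IsLinear (λ μ → iterate O μ n)
iterate-linear O-lin zero    = id-linear
iterate-linear O-lin (suc n) = ∘-linear (iterate-linear O-lin n) O-lin

-- The form p ↦ μ ((x + c) p).
mulX+ : ℚ → Form → Form
mulX+ c μ = c ·ᶠ μ +ᶠ μ ∘ suc

mulX+-linear : ∀ c → IsLinear (mulX+ c)
mulX+-linear c = record
  { cong-≗  = λ μ≗ν i → cong₂ (λ u v → c * u + v) (μ≗ν i) (μ≗ν (suc i))
  ; +ᶠ-homo = λ μ ν i → distrib-+ c (μ i) (ν i) (μ (suc i)) (ν (suc i))
  ; ·ᶠ-homo = λ a μ i → distrib-· c a (μ i) (μ (suc i))
  }
  where
  distrib-+ : ∀ c x y x′ y′ → c * (x + y) + (x′ + y′) ≡ (c * x + x′) + (c * y + y′)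
  distrib-+ = solve-∀ ℚ-ring
  distrib-· : ∀ c a x x′ → c * (a * x) + a * x′ ≡ a * (c * x + x′)
  distrib-· = solve-∀ ℚ-ring

mulX+-comm : ∀ c d μ → mulX+ c (mulX+ d μ) ≗ mulX+ d (mulX+ c μ)
mulX+-comm c d μ i = comm c d (μ i) (μ (suc i)) (μ (suc (suc i)))
  where
  comm : ∀ c d x y z → c * (d * x + y) + (d * y + z) ≡ d * (c * x + y) + (c * y + z)
  comm = solve-∀ ℚ-ring

-- If O ν is the form p ↦ ν (u p), then pushforward O ν is the form p ↦ ν (p ∘ u).
pushforward : (Form → Form) → Form → Form
pushforward O ν n = iterate O ν n 0

pushforward-linear : ∀ {O} → IsLinear O → IsLinear (pushforward O)
pushforward-linear O-lin = record
  { cong-≗  = λ μ≗ν n → cong-≗ (iterate-linear O-lin n) μ≗ν 0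
  ; +ᶠ-homo = λ μ ν n → +ᶠ-homo (iterate-linear O-lin n) μ ν 0
  ; ·ᶠ-homo = λ a μ n → ·ᶠ-homo (iterate-linear O-lin n) a μ 0
  }

mulX+-pushforward : ∀ {O} → IsLinear O → ∀ c μ → mulX+ c (pushforward O μ) ≗ pushforward O (c ·ᶠ μ +ᶠ O μ)
mulX+-pushforward {O} O-lin c μ n = sym (trans (+ᶠ-homo O* (c ·ᶠ μ) (O μ) n)
  (cong (_+ pushforward O (O μ) n) (·ᶠ-homo O* c μ n)))
  where O* = pushforward-linear O-lin

sumTo-cong< : ∀ n {f g} → (∀ i → i ℕ.< n → f i ≡ g i) → sumTo n f ≡ sumTo n g
sumTo-cong< zero    f≡g = refl
sumTo-cong< (suc n) f≡g = cong₂ _+_ (sumTo-cong< n (λ i i<n → f≡g i (ℕP.m<n⇒m<1+n i<n))) (f≡g n (ℕP.n<1+n n))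

sumTo-cong : ∀ n {f g} → f ≗ g → sumTo n f ≡ sumTo n g
sumTo-cong n f≗g = sumTo-cong< n (λ i _ → f≗g i)

sumTo-+ : ∀ n f g → sumTo n (λ i → f i + g i) ≡ sumTo n f + sumTo n g
sumTo-+ zero    f g = sym (ℚP.+-identityʳ 0ℚ)
sumTo-+ (suc n) f g = trans (cong (_+ (f n + g n)) (sumTo-+ n f g)) (interchange (sumTo n f) (sumTo n g) (f n) (g n))
  where
  interchange : ∀ a b c d → a + b + (c + d) ≡ a + c + (b + d)
  interchange = solve-∀ ℚ-ring

sumTo-head : ∀ n f → sumTo (suc n) f ≡ f 0 + sumTo n (f ∘ suc)
sumTo-head zero    f = trans (ℚP.+-identityˡ (f 0)) (sym (ℚP.+-identityʳ (f 0)))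
sumTo-head (suc n) f = trans (cong (_+ f (suc n)) (sumTo-head n f)) (ℚP.+-assoc (f 0) _ _)

sumTo-0 : ∀ n → sumTo n (λ _ → 0ℚ) ≡ 0ℚ
sumTo-0 zero    = refl
sumTo-0 (suc n) = trans (ℚP.+-identityʳ _) (sumTo-0 n)

-- The form p ↦ μ (p (x + 1)).
translate : Form → Form
translate = pushforward (mulX+ 1ℚ)

translate-linear : IsLinear translate
translate-linear = pushforward-linear (mulX+-linear 1ℚ)

mulX+-translate : ∀ c μ → mulX+ c (translate μ) ≗ translate (mulX+ (c + 1ℚ) μ)
mulX+-translate c μ n = trans (mulX+-pushforward (mulX+-linear 1ℚ) c μ n)
  (cong-≗ translate-linear (λ i → collect c (μ i) (μ (suc i))) n)
  where
  collect : ∀ c x y → c * x + (1ℚ * x + y) ≡ (c + 1ℚ) * x + y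
  collect = solve-∀ ℚ-ring

translate-binomial : ∀ n μ → translate μ n ≡ sumTo (suc n) (λ i → ι (n C i) * μ i)
translate-binomial zero    μ = sym (trans (ℚP.+-identityˡ _) (ℚP.*-identityˡ (μ 0)))
translate-binomial (suc n) μ = begin
  translate (mulX+ 1ℚ μ) n
    ≡⟨ translate-binomial n (mulX+ 1ℚ μ) ⟩
  sumTo (suc n) (λ i → c n i * (1ℚ * μ i + μ (suc i)))
    ≡⟨ trans (sumTo-cong (suc n) (λ i → distrib (c n i) (μ i) (μ (suc i)))) (sumTo-+ (suc n) (λ i → c n i * μ i) low) ⟩
  sumTo (suc n) (λ i → c n i * μ i) + sumTo (suc n) low
    ≡⟨ cong (_+ sumTo (suc n) low) (trans (sumTo-head n (λ i → c n i * μ i)) (cong (1ℚ * μ 0 +_) top-vanishes)) ⟩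
  1ℚ * μ 0 + sumTo (suc n) high + sumTo (suc n) low
    ≡⟨ trans (ℚP.+-assoc (1ℚ * μ 0) _ _) (cong (1ℚ * μ 0 +_) (trans (ℚP.+-comm (sumTo (suc n) high) (sumTo (suc n) low)) (sym (sumTo-+ (suc n) low high)))) ⟩
  1ℚ * μ 0 + sumTo (suc n) (λ i → low i + high i)
    ≡⟨ cong (1ℚ * μ 0 +_) (sumTo-cong (suc n) pascal) ⟩
  1ℚ * μ 0 + sumTo (suc n) (λ i → c (suc n) (suc i) * μ (suc i))
    ≡⟨ sym (sumTo-head (suc n) (λ i → c (suc n) i * μ i)) ⟩
  sumTo (suc (suc n)) (λ i → c (suc n) i * μ i) ∎
  where
  open ≡-Reasoning
  c : ℕ → ℕ → ℚ
  c n i = ι (n C i)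
  low high : ℕ → ℚ
  low  i = c n i * μ (suc i)
  high i = c n (suc i) * μ (suc i)
  distrib : ∀ c x y → c * (1ℚ * x + y) ≡ c * x + c * y
  distrib = solve-∀ ℚ-ring
  top-vanishes : sumTo n high ≡ sumTo (suc n) high
  top-vanishes = sym (trans (cong (λ k → sumTo n high + ι k * μ (suc n)) (k>n⇒nCk≡0 (ℕP.n<1+n n)))
    (trans (cong (sumTo n high +_) (ℚP.*-zeroˡ (μ (suc n)))) (ℚP.+-identityʳ (sumTo n high))))
  pascal : ∀ i → low i + high i ≡ c (suc n) (suc i) * μ (suc i)
  pascal i = trans (sym (ℚP.*-distribʳ-+ (μ (suc i)) (c n i) (c n (suc i))))
    (cong (_* μ (suc i)) (trans (sym (ι-homo-+ (n C i) (n C suc i))) (cong ι (nCk+nC[k+1]≡[n+1]C[k+1] n i))))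

bernUpTo≡bernoulli : ∀ n k → k ℕ.≤ n → bernUpTo n k ≡ bernoulli k
bernUpTo≡bernoulli zero    zero    z≤n = refl
bernUpTo≡bernoulli (suc n) k       k≤1+n with ℕP.m≤n⇒m<n∨m≡n k≤1+n
... | inj₂ refl = refl
... | inj₁ k≤n  with k ℕ.≤ᵇ n | ℕP.≤⇒≤ᵇ (ℕP.≤-pred k≤n)
...   | true  | _ = bernUpTo≡bernoulli n k (ℕP.≤-pred k≤n)

bernoulli-suc : ∀ n → bernoulli (suc n) ≡
  - ((ℤ.+ 1 ℚ./ suc (suc n)) * sumTo (suc n) (λ j → ι (suc (suc n) C j) * bernoulli j))
bernoulli-suc n with suc n ℕ.≤ᵇ n in eq
... | true  = ⊥-elim (ℕP.n≮n n (ℕP.≤ᵇ⇒≤ (suc n) n (subst T (sym eq) tt)))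
... | false = cong (λ s → - ((ℤ.+ 1 ℚ./ suc (suc n)) * s)) (sumTo-cong< (suc n)
  (λ j j<1+n → cong (ι (suc (suc n) C j) *_) (bernUpTo≡bernoulli n j (ℕP.≤-pred j<1+n))))

bernoulli-recurrence : ∀ n → sumTo (suc (suc n)) (λ i → ι (suc (suc n) C i) * bernoulli i) ≡ 0ℚ
bernoulli-recurrence n = begin
  S + ι (N C suc n) * bernoulli (suc n)     ≡⟨ cong₂ (λ k b → S + ι k * b) N-C-1+n (bernoulli-suc n) ⟩
  S + ι N * - ((ℤ.+ 1 ℚ./ N) * S)           ≡⟨ cancel S (ι N) (ℤ.+ 1 ℚ./ N) (ι-*-reciprocal (suc n)) ⟩
  0ℚ                                        ∎
  where
  open ≡-Reasoning
  N = suc (suc n)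
  S = sumTo (suc n) (λ i → ι (N C i) * bernoulli i)
  N-C-1+n : N C suc n ≡ N
  N-C-1+n = trans (nCk≡nC[n∸k] (ℕP.n≤1+n (suc n))) (trans (cong (N C_) (ℕP.m+n∸n≡m 1 (suc n))) (nC1≡n N))
  cancel : ∀ s x r → x * r ≡ 1ℚ → s + x * - (r * s) ≡ 0ℚ
  cancel s x r xr≡1 = begin
    s + x * - (r * s)   ≡⟨ rearrange s x r ⟩
    s + - (x * r) * s   ≡⟨ cong (λ t → s + - t * s) xr≡1 ⟩
    s + - 1ℚ * s        ≡⟨ vanish s ⟩
    0ℚ                  ∎
    where
    rearrange : ∀ s x r → s + x * - (r * s) ≡ s + - (x * r) * s
    rearrange = solve-∀ ℚ-ring
    vanish : ∀ s → s + - 1ℚ * s ≡ 0ℚ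
    vanish = solve-∀ ℚ-ring

-- The form p ↦ p′(0).
δ₁ : Form
δ₁ (suc zero) = 1ℚ
δ₁ _          = 0ℚ

translate-bernoulli : translate bernoulli ≗ bernoulli +ᶠ δ₁
translate-bernoulli zero          = refl
translate-bernoulli (suc zero)    = refl
translate-bernoulli (suc (suc n)) = begin
  translate bernoulli (suc (suc n))
    ≡⟨ translate-binomial (suc (suc n)) bernoulli ⟩
  sumTo (suc (suc n)) (λ i → ι (suc (suc n) C i) * bernoulli i) + ι (suc (suc n) C suc (suc n)) * bernoulli (suc (suc n))
    ≡⟨ cong₂ (λ s k → s + ι k * bernoulli (suc (suc n))) (bernoulli-recurrence n) (nCn≡1 (suc (suc n))) ⟩
  0ℚ + 1ℚ * bernoulli (suc (suc n))
    ≡⟨ tidy (bernoulli (suc (suc n))) ⟩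
  bernoulli (suc (suc n)) + 0ℚ ∎
  where
  open ≡-Reasoning
  tidy : ∀ b → 0ℚ + 1ℚ * b ≡ b + 0ℚ
  tidy = solve-∀ ℚ-ring

-- The moments Ψ(h_j)

mulPairs : (ℕ → ℚ) → (ℕ → ℚ) → ℕ → Form → Form
mulPairs a b zero    = id
mulPairs a b (suc j) = mulX+ (a j) ∘ mulX+ (b j) ∘ mulPairs a b j

mulPairs-linear : ∀ a b j → IsLinear (mulPairs a b j)
mulPairs-linear a b zero    = id-linear
mulPairs-linear a b (suc j) = ∘-linear (∘-linear (mulX+-linear (a j)) (mulX+-linear (b j))) (mulPairs-linear a b j)

mulPairs-mulX+ : ∀ a b j c μ → mulPairs a b j (mulX+ c μ) ≗ mulX+ c (mulPairs a b j μ)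
mulPairs-mulX+ a b zero    c μ i = refl
mulPairs-mulX+ a b (suc j) c μ i = begin
  mulX+ (a j) (mulX+ (b j) (mulPairs a b j (mulX+ c μ))) i
    ≡⟨ cong-≗ (∘-linear (mulX+-linear (a j)) (mulX+-linear (b j))) (mulPairs-mulX+ a b j c μ) i ⟩
  mulX+ (a j) (mulX+ (b j) (mulX+ c (mulPairs a b j μ))) i
    ≡⟨ cong-≗ (mulX+-linear (a j)) (λ i → sym (mulX+-comm c (b j) (mulPairs a b j μ) i)) i ⟩
  mulX+ (a j) (mulX+ c (mulX+ (b j) (mulPairs a b j μ))) i
    ≡⟨ sym (mulX+-comm c (a j) (mulX+ (b j) (mulPairs a b j μ)) i) ⟩
  mulX+ c (mulX+ (a j) (mulX+ (b j) (mulPairs a b j μ))) i ∎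
  where open ≡-Reasoning

mulPairs-translate : ∀ a b j μ →
  mulPairs a b j (translate μ) ≗ translate (mulPairs (λ k → a k + 1ℚ) (λ k → b k + 1ℚ) j μ)
mulPairs-translate a b zero    μ i = refl
mulPairs-translate a b (suc j) μ i = begin
  mulX+ (a j) (mulX+ (b j) (mulPairs a b j (translate μ))) i
    ≡⟨ cong-≗ (∘-linear (mulX+-linear (a j)) (mulX+-linear (b j))) (mulPairs-translate a b j μ) i ⟩
  mulX+ (a j) (mulX+ (b j) (translate ν)) i
    ≡⟨ cong-≗ (mulX+-linear (a j)) (mulX+-translate (b j) ν) i ⟩
  mulX+ (a j) (translate (mulX+ (b j + 1ℚ) ν)) i
    ≡⟨ mulX+-translate (a j) (mulX+ (b j + 1ℚ) ν) i ⟩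
  translate (mulX+ (a j + 1ℚ) (mulX+ (b j + 1ℚ) ν)) i ∎
  where
  open ≡-Reasoning
  ν = mulPairs (λ k → a k + 1ℚ) (λ k → b k + 1ℚ) j μ

mulX+-rotate : ∀ c d e μ → mulX+ c (mulX+ d (mulX+ e μ)) ≗ mulX+ d (mulX+ e (mulX+ c μ))
mulX+-rotate c d e μ i = trans (mulX+-comm c d (mulX+ e μ) i) (cong-≗ (mulX+-linear d) (mulX+-comm c e μ) i)

-- Multiplication by h_j(x) = ∏_{k<j} (x + k + 1)(x − k) = ∏_{k<j} (x(x+1) − k(k+1)),
-- and by its translate h_j(x + 1).
mulH mulH⁺ : ℕ → Form → Form
mulH  = mulPairs (λ k → ι (suc k)) (λ k → - ι k)
mulH⁺ = mulPairs (λ k → ι (suc k) + 1ℚ) (λ k → - ι k + 1ℚ)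

mulH-linear : ∀ j → IsLinear (mulH j)
mulH-linear = mulPairs-linear (λ k → ι (suc k)) (λ k → - ι k)

mulH⁺-linear : ∀ j → IsLinear (mulH⁺ j)
mulH⁺-linear = mulPairs-linear (λ k → ι (suc k) + 1ℚ) (λ k → - ι k + 1ℚ)

-- (x + 1 − j) h_j(x + 1) = (x + j + 1) h_j(x): both are ∏_{|i| ≤ j} (x + 1 + i).
mulH⁺-realign : ∀ j μ → mulX+ (- ι j + 1ℚ) (mulH⁺ j μ) ≗ mulX+ (ι j + 1ℚ) (mulH j μ)
mulH⁺-realign zero    μ i = refl
mulH⁺-realign (suc j) μ i = begin
  mulX+ (- ι (suc j) + 1ℚ) (mulX+ (ι (suc j) + 1ℚ) (mulX+ (- ι j + 1ℚ) (mulH⁺ j μ))) i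
    ≡⟨ cong-≗ (∘-linear (mulX+-linear (- ι (suc j) + 1ℚ)) (mulX+-linear (ι (suc j) + 1ℚ))) (mulH⁺-realign j μ) i ⟩
  mulX+ (- ι (suc j) + 1ℚ) (mulX+ (ι (suc j) + 1ℚ) (mulX+ (ι j + 1ℚ) (mulH j μ))) i
    ≡⟨ cong₂ (λ c d → mulX+ c (mulX+ (ι (suc j) + 1ℚ) (mulX+ d (mulH j μ))) i) −[1+j]+1≡−j (sym (ι-suc j)) ⟩
  mulX+ (- ι j) (mulX+ (ι (suc j) + 1ℚ) (mulX+ (ι (suc j)) (mulH j μ))) i
    ≡⟨ mulX+-rotate (- ι j) (ι (suc j) + 1ℚ) (ι (suc j)) (mulH j μ) i ⟩
  mulX+ (ι (suc j) + 1ℚ) (mulX+ (ι (suc j)) (mulX+ (- ι j) (mulH j μ))) i ∎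
  where
  open ≡-Reasoning
  cancel : ∀ x → - (x + 1ℚ) + 1ℚ ≡ - x
  cancel = solve-∀ ℚ-ring
  −[1+j]+1≡−j : - ι (suc j) + 1ℚ ≡ - ι j
  −[1+j]+1≡−j = trans (cong (λ t → - t + 1ℚ) (ι-suc j)) (cancel (ι j))

bernoulliH : ℕ → ℚ
bernoulliH j = mulH j bernoulli 0

odd : ℕ → ℚ
odd k = ι k + ι k + 1ℚ

-- Apply Ψ(p(x + 1)) = Ψ(p) + p′(0) to p = (x − j) h_j and realign the translate.
bernoulliH-recursion : ∀ j → odd j * bernoulliH j ≡ mulX+ (- ι j) (mulH j δ₁) 0
bernoulliH-recursion j = isolate (ι j) (X 0) (Y 0) (X 1) (Y 1) (trans (sym via-bernoulli) via-realign)
  where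
  open ≡-Reasoning
  X = mulH j bernoulli
  Y = mulH j δ₁
  via-realign : mulX+ (- ι j) (mulH j (translate bernoulli)) 0 ≡ mulX+ (ι j + 1ℚ) X 0
  via-realign = begin
    mulX+ (- ι j) (mulH j (translate bernoulli)) 0
      ≡⟨ cong-≗ (mulX+-linear (- ι j)) (mulPairs-translate (λ k → ι (suc k)) (λ k → - ι k) j bernoulli) 0 ⟩
    mulX+ (- ι j) (translate (mulH⁺ j bernoulli)) 0
      ≡⟨ mulX+-translate (- ι j) (mulH⁺ j bernoulli) 0 ⟩
    mulX+ (- ι j + 1ℚ) (mulH⁺ j bernoulli) 0
      ≡⟨ mulH⁺-realign j bernoulli 0 ⟩
    mulX+ (ι j + 1ℚ) X 0 ∎
  via-bernoulli : mulX+ (- ι j) (mulH j (translate bernoulli)) 0 ≡ - ι j * (X 0 + Y 0) + (X 1 + Y 1)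
  via-bernoulli = cong-≗ (mulX+-linear (- ι j))
    (λ i → trans (cong-≗ (mulH-linear j) translate-bernoulli i) (+ᶠ-homo (mulH-linear j) bernoulli δ₁ i)) 0
  isolate : ∀ t x₀ y₀ x₁ y₁ → - t * (x₀ + y₀) + (x₁ + y₁) ≡ (t + 1ℚ) * x₀ + x₁ →
            (t + t + 1ℚ) * x₀ ≡ - t * y₀ + y₁
  isolate t x₀ y₀ x₁ y₁ eq = begin
    (t + t + 1ℚ) * x₀                                         ≡⟨ expand t x₀ x₁ ⟩
    ((t + 1ℚ) * x₀ + x₁) + - x₁ + t * x₀                      ≡⟨ cong (λ w → w + - x₁ + t * x₀) (sym eq) ⟩
    (- t * (x₀ + y₀) + (x₁ + y₁)) + - x₁ + t * x₀             ≡⟨ contract t x₀ y₀ x₁ y₁ ⟩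
    - t * y₀ + y₁                                             ∎
    where
    expand : ∀ t x₀ x₁ → (t + t + 1ℚ) * x₀ ≡ ((t + 1ℚ) * x₀ + x₁) + - x₁ + t * x₀
    expand = solve-∀ ℚ-ring
    contract : ∀ t x₀ y₀ x₁ y₁ → (- t * (x₀ + y₀) + (x₁ + y₁)) + - x₁ + t * x₀ ≡ - t * y₀ + y₁
    contract = solve-∀ ℚ-ring

sign : ℕ → ℚ
sign zero    = 1ℚ
sign (suc k) = - sign k

factorial : ℕ → ℚ
factorial = poch 1ℚ

δ₀ : Form
δ₀ zero    = 1ℚ
δ₀ (suc _) = 0ℚ

mulX+-δ₀ : ∀ c a → mulX+ c (a ·ᶠ δ₀) ≗ (c * a) ·ᶠ δ₀
mulX+-δ₀ c a zero    = at-0 c a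
  where
  at-0 : ∀ c a → c * (a * 1ℚ) + a * 0ℚ ≡ c * a * 1ℚ
  at-0 = solve-∀ ℚ-ring
mulX+-δ₀ c a (suc i) = elsewhere c a
  where
  elsewhere : ∀ c a → c * (a * 0ℚ) + a * 0ℚ ≡ c * a * 0ℚ
  elsewhere = solve-∀ ℚ-ring

-- h_{j+1}(0) = 0, so (h_{j+1} p)′(0) = h′_{j+1}(0) p(0).
mulH-δ₁ : ∀ j → mulH (suc j) δ₁ ≗ (sign j * (factorial j * factorial (suc j))) ·ᶠ δ₀
mulH-δ₁ zero    zero          = refl
mulH-δ₁ zero    (suc zero)    = refl
mulH-δ₁ zero    (suc (suc i)) = refl
mulH-δ₁ (suc j) i = begin
  mulX+ (ι (suc (suc j))) (mulX+ (- ι (suc j)) (mulH (suc j) δ₁)) i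
    ≡⟨ cong-≗ (∘-linear (mulX+-linear (ι (suc (suc j)))) (mulX+-linear (- ι (suc j)))) (mulH-δ₁ j) i ⟩
  mulX+ (ι (suc (suc j))) (mulX+ (- ι (suc j)) (k ·ᶠ δ₀)) i
    ≡⟨ trans (cong-≗ (mulX+-linear (ι (suc (suc j)))) (mulX+-δ₀ (- ι (suc j)) k) i) (mulX+-δ₀ (ι (suc (suc j))) _ i) ⟩
  (ι (suc (suc j)) * (- ι (suc j) * k)) * δ₀ i
    ≡⟨ cong (_* δ₀ i) coefficient ⟩
  (sign (suc j) * (factorial (suc j) * factorial (suc (suc j)))) * δ₀ i ∎
  where
  open ≡-Reasoning
  k = sign j * (factorial j * factorial (suc j))
  coefficient : ι (suc (suc j)) * (- ι (suc j) * k) ≡ sign (suc j) * (factorial (suc j) * factorial (suc (suc j)))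
  coefficient = begin
    ι (suc (suc j)) * (- ι (suc j) * k)
      ≡⟨ cong₂ (λ u v → u * (- v * k)) (trans (ι-suc (suc j)) (cong (_+ 1ℚ) (ι-suc j))) (ι-suc j) ⟩
    (ι j + 1ℚ + 1ℚ) * (- (ι j + 1ℚ) * k)
      ≡⟨ regroup (ι j) (sign j) (factorial j) ⟩
    - sign j * ((factorial j * (1ℚ + ι j)) * ((factorial j * (1ℚ + ι j)) * (1ℚ + (ι j + 1ℚ))))
      ≡⟨ cong (λ v → - sign j * ((factorial j * (1ℚ + ι j)) * ((factorial j * (1ℚ + ι j)) * (1ℚ + v)))) (sym (ι-suc j)) ⟩
    sign (suc j) * (factorial (suc j) * factorial (suc (suc j))) ∎
    where
    regroup : ∀ x s f → (x + 1ℚ + 1ℚ) * (- (x + 1ℚ) * (s * (f * (f * (1ℚ + x)))))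
                        ≡ - s * ((f * (1ℚ + x)) * ((f * (1ℚ + x)) * (1ℚ + (x + 1ℚ))))
    regroup = solve-∀ ℚ-ring

bernoulliH-closed : ∀ j → odd j * bernoulliH j ≡ sign j * (factorial j * factorial j)
bernoulliH-closed zero    = bernoulliH-recursion zero
bernoulliH-closed (suc j) = begin
  odd (suc j) * bernoulliH (suc j)
    ≡⟨ bernoulliH-recursion (suc j) ⟩
  - ι (suc j) * mulH (suc j) δ₁ 0 + mulH (suc j) δ₁ 1
    ≡⟨ cong₂ (λ u v → - u * v + mulH (suc j) δ₁ 1) (ι-suc j) (mulH-δ₁ j 0) ⟩
  - (ι j + 1ℚ) * (k * 1ℚ) + mulH (suc j) δ₁ 1
    ≡⟨ cong (- (ι j + 1ℚ) * (k * 1ℚ) +_) (mulH-δ₁ j 1) ⟩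
  - (ι j + 1ℚ) * (k * 1ℚ) + k * 0ℚ
    ≡⟨ regroup (ι j) (sign j) (factorial j) ⟩
  sign (suc j) * (factorial (suc j) * factorial (suc j)) ∎
  where
  open ≡-Reasoning
  k = sign j * (factorial j * factorial (suc j))
  regroup : ∀ x s f → - (x + 1ℚ) * (s * (f * (f * (1ℚ + x))) * 1ℚ) + s * (f * (f * (1ℚ + x))) * 0ℚ
                      ≡ - s * ((f * (1ℚ + x)) * (f * (1ℚ + x)))
  regroup = solve-∀ ℚ-ring

-- Λ on the factors P_k

-- Multiplication by u(x) = (x + 1)(x + 2) = 2 binom(x+2, 2).
mulU : Form → Form
mulU = mulX+ 1ℚ ∘ mulX+ (ι 2)

mulU-linear : IsLinear mulU
mulU-linear = ∘-linear (mulX+-linear 1ℚ) (mulX+-linear (ι 2))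

2^k*evalForm-binomPower : ∀ k μ → ι (2 ℕ.^ k) * evalForm μ (ppow binomX+2-2 k) ≡ pushforward mulU μ k
2^k*evalForm-binomPower zero    μ = trans (cong (1ℚ *_) (evalForm-pconst μ 1ℚ)) (unit (μ 0))
  where
  unit : ∀ x → 1ℚ * (1ℚ * x) ≡ x
  unit = solve-∀ ℚ-ring
2^k*evalForm-binomPower (suc k) μ = begin
  ι (2 ℕ.* 2 ℕ.^ k) * evalForm μ (pmul (ppow binomX+2-2 k) binomX+2-2)
    ≡⟨ cong₂ _*_ (ι-homo-* 2 (2 ℕ.^ k)) (evalForm-pmul μ (ppow binomX+2-2 k) binomX+2-2) ⟩
  ι 2 * ι (2 ℕ.^ k) * evalForm (μ ⋆ binomX+2-2) (ppow binomX+2-2 k)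
    ≡⟨ trans (swap (ι 2) (ι (2 ℕ.^ k)) _) (cong (ι (2 ℕ.^ k) *_) (sym (evalForm-·ᶠ (ι 2) (μ ⋆ binomX+2-2) (ppow binomX+2-2 k)))) ⟩
  ι (2 ℕ.^ k) * evalForm (ι 2 ·ᶠ (μ ⋆ binomX+2-2)) (ppow binomX+2-2 k)
    ≡⟨ cong (ι (2 ℕ.^ k) *_) (evalForm-cong 2·binom≗u (ppow binomX+2-2 k)) ⟩
  ι (2 ℕ.^ k) * evalForm (mulU μ) (ppow binomX+2-2 k)
    ≡⟨ 2^k*evalForm-binomPower k (mulU μ) ⟩
  pushforward mulU (mulU μ) k ∎
  where
  open ≡-Reasoning
  swap : ∀ a b e → a * b * e ≡ b * (a * e)
  swap = solve-∀ ℚ-ring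
  expand : ∀ x y z → ι 2 * (1ℚ * x + (ℤ.+ 3 ℚ./ 2) * y + (ℤ.+ 1 ℚ./ 2) * z) ≡ 1ℚ * (ι 2 * x + y) + (ι 2 * y + z)
  expand = solve-∀ ℚ-ring
  2·binom≗u : ι 2 ·ᶠ (μ ⋆ binomX+2-2) ≗ mulU μ
  2·binom≗u i = trans (cong (ι 2 *_) (⋆-quadratic μ 1ℚ (ℤ.+ 3 ℚ./ 2) (ℤ.+ 1 ℚ./ 2) i))
    (expand (μ i) (μ (suc i)) (μ (suc (suc i))))

-- That is, Λ(p(y)) = (15/2) Ψ(u² p(u)).
claimedMoment≡ : ∀ n → claimedMoment n ≡ (ℤ.+ 15 ℚ./ 2) * pushforward mulU (mulU (mulU bernoulli)) n
claimedMoment≡ n = begin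
  ι (2 ℕ.^ n) * ℛ⁺ (n ℕ.+ 2) * 1/ ℛ⁺ 2
    ≡⟨ cong (λ k → ι (2 ℕ.^ n) * ℛ⁺ k * 1/ ℛ⁺ 2) (ℕP.+-comm n 2) ⟩
  ι (2 ℕ.^ n) * ℛ⁺ (2 ℕ.+ n) * 1/ ℛ⁺ 2
    ≡⟨ quarter (ι (2 ℕ.^ n)) (ℛ⁺ (2 ℕ.+ n)) ⟩
  ι 2 * (ι 2 * ι (2 ℕ.^ n)) * ℛ⁺ (2 ℕ.+ n) * ((ℤ.+ 1 ℚ./ 4) * 1/ ℛ⁺ 2)
    ≡⟨ cong (λ t → t * ℛ⁺ (2 ℕ.+ n) * ((ℤ.+ 1 ℚ./ 4) * 1/ ℛ⁺ 2))
         (sym (trans (ι-homo-* 2 (2 ℕ.* 2 ℕ.^ n)) (cong (ι 2 *_) (ι-homo-* 2 (2 ℕ.^ n))))) ⟩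
  ι (2 ℕ.^ (2 ℕ.+ n)) * ℛ⁺ (2 ℕ.+ n) * (ℤ.+ 15 ℚ./ 2)
    ≡⟨ cong (λ r → ι (2 ℕ.^ (2 ℕ.+ n)) * r * (ℤ.+ 15 ℚ./ 2)) (applyForm≡evalForm bernoulli (ppow binomX+2-2 (2 ℕ.+ n))) ⟩
  ι (2 ℕ.^ (2 ℕ.+ n)) * evalForm bernoulli (ppow binomX+2-2 (2 ℕ.+ n)) * (ℤ.+ 15 ℚ./ 2)
    ≡⟨ trans (cong (_* (ℤ.+ 15 ℚ./ 2)) (2^k*evalForm-binomPower (2 ℕ.+ n) bernoulli)) (ℚP.*-comm (pushforward mulU bernoulli (2 ℕ.+ n)) (ℤ.+ 15 ℚ./ 2)) ⟩
  (ℤ.+ 15 ℚ./ 2) * pushforward mulU (mulU (mulU bernoulli)) n ∎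
  where
  open ≡-Reasoning
  quarter : ∀ x r → x * r * 1/ ℛ⁺ 2 ≡ ι 2 * (ι 2 * x) * r * ((ℤ.+ 1 ℚ./ 4) * 1/ ℛ⁺ 2)
  quarter = solve-∀ ℚ-ring

-- The factors (-x)_k (x+γ+δ+1)_k of the Racah polynomials, for (γ, δ) = (1, -1),
-- as polynomials in y = λ(x); node k = λ(k) = k(k+1) is the root of the k-th factor.
racahFactorₙ : ℕ → Poly
racahFactorₙ = racahFactor 1ℚ (- 1ℚ)

node : ℕ → ℚ
node k = ι k * (ι k + 1ℚ + - 1ℚ + 1ℚ)

-- node k − u(x) = −(x + k + 2)(x − k + 1)
node-mulU : ∀ k ν → node k ·ᶠ ν +ᶠ - 1ℚ ·ᶠ mulU ν ≗ - 1ℚ ·ᶠ mulX+ (ι (suc k) + 1ℚ) (mulX+ (- ι k + 1ℚ) ν)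
node-mulU k ν i = trans (factor (ι k) (ν i) (ν (suc i)) (ν (suc (suc i))))
  (cong (λ t → - 1ℚ * ((t + 1ℚ) * ((- ι k + 1ℚ) * ν i + ν (suc i)) + ((- ι k + 1ℚ) * ν (suc i) + ν (suc (suc i))))) (sym (ι-suc k)))
  where
  factor : ∀ x a b c → x * (x + 1ℚ + - 1ℚ + 1ℚ) * a + - 1ℚ * (1ℚ * (ι 2 * a + b) + (ι 2 * b + c))
                       ≡ - 1ℚ * ((x + 1ℚ + 1ℚ) * ((- x + 1ℚ) * a + b) + ((- x + 1ℚ) * b + c))
  factor = solve-∀ ℚ-ring

-- Substituting y = u(x) turns the factor ∏_{j<k} (node j − y) into (−1)^k h_k(x + 1).
evalForm-racahFactor : ∀ k ν → evalForm (pushforward mulU ν) (racahFactorₙ k) ≡ sign k * mulH⁺ k ν 0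
evalForm-racahFactor zero    ν = evalForm-pconst (pushforward mulU ν) 1ℚ
evalForm-racahFactor (suc k) ν = begin
  evalForm (pushforward mulU ν) (pmul (racahFactorₙ k) (node k ∷ - 1ℚ ∷ []))
    ≡⟨ evalForm-pmul (pushforward mulU ν) (racahFactorₙ k) (node k ∷ - 1ℚ ∷ []) ⟩
  evalForm (pushforward mulU ν ⋆ (node k ∷ - 1ℚ ∷ [])) (racahFactorₙ k)
    ≡⟨ evalForm-cong substitute (racahFactorₙ k) ⟩
  evalForm (pushforward mulU (- 1ℚ ·ᶠ mulX+ a (mulX+ b ν))) (racahFactorₙ k)
    ≡⟨ evalForm-racahFactor k (- 1ℚ ·ᶠ mulX+ a (mulX+ b ν)) ⟩
  sign k * mulH⁺ k (- 1ℚ ·ᶠ mulX+ a (mulX+ b ν)) 0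
    ≡⟨ cong (sign k *_) (·ᶠ-homo (mulH⁺-linear k) (- 1ℚ) (mulX+ a (mulX+ b ν)) 0) ⟩
  sign k * (- 1ℚ * mulH⁺ k (mulX+ a (mulX+ b ν)) 0)
    ≡⟨ cong (λ t → sign k * (- 1ℚ * t)) commute ⟩
  sign k * (- 1ℚ * mulX+ a (mulX+ b (mulH⁺ k ν)) 0)
    ≡⟨ flip-sign (sign k) _ ⟩
  - sign k * mulX+ a (mulX+ b (mulH⁺ k ν)) 0 ∎
  where
  open ≡-Reasoning
  a = ι (suc k) + 1ℚ
  b = - ι k + 1ℚ
  substitute : pushforward mulU ν ⋆ (node k ∷ - 1ℚ ∷ []) ≗ pushforward mulU (- 1ℚ ·ᶠ mulX+ a (mulX+ b ν))
  substitute i = begin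
    (pushforward mulU ν ⋆ (node k ∷ - 1ℚ ∷ [])) i
      ≡⟨ ⋆-linear (pushforward mulU ν) (node k) (- 1ℚ) i ⟩
    (node k ·ᶠ pushforward mulU ν +ᶠ - 1ℚ ·ᶠ pushforward mulU (mulU ν)) i
      ≡⟨ cong₂ _+_ (sym (·ᶠ-homo U*-linear (node k) ν i)) (sym (·ᶠ-homo U*-linear (- 1ℚ) (mulU ν) i)) ⟩
    (pushforward mulU (node k ·ᶠ ν) +ᶠ pushforward mulU (- 1ℚ ·ᶠ mulU ν)) i
      ≡⟨ sym (+ᶠ-homo U*-linear (node k ·ᶠ ν) (- 1ℚ ·ᶠ mulU ν) i) ⟩
    pushforward mulU (node k ·ᶠ ν +ᶠ - 1ℚ ·ᶠ mulU ν) i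
      ≡⟨ cong-≗ U*-linear (node-mulU k ν) i ⟩
    pushforward mulU (- 1ℚ ·ᶠ mulX+ a (mulX+ b ν)) i ∎
    where U*-linear = pushforward-linear mulU-linear
  commute : mulH⁺ k (mulX+ a (mulX+ b ν)) 0 ≡ mulX+ a (mulX+ b (mulH⁺ k ν)) 0
  commute = trans (mulPairs-mulX+ _ _ k a (mulX+ b ν) 0) (cong-≗ (mulX+-linear a) (mulPairs-mulX+ _ _ k b ν) 0)
  flip-sign : ∀ s t → s * (- 1ℚ * t) ≡ - s * t
  flip-sign = solve-∀ ℚ-ring

-- Multiplication by v(x) = x(x + 1) = u(x − 1).
mulV : Form → Form
mulV = mulX+ 0ℚ ∘ mulX+ 1ℚ

mulV-linear : IsLinear mulV
mulV-linear = ∘-linear (mulX+-linear 0ℚ) (mulX+-linear 1ℚ)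

translate-mulU : ∀ μ → translate (mulU μ) ≗ mulV (translate μ)
translate-mulU μ i = sym (trans (cong-≗ (mulX+-linear 0ℚ) (mulX+-translate 1ℚ μ) i) (mulX+-translate 0ℚ (mulX+ (1ℚ + 1ℚ) μ) i))

mulV²-δ₁ : mulV (mulV δ₁) ≗ 0ᶠ
mulV²-δ₁ zero                      = refl
mulV²-δ₁ (suc zero)                = refl
mulV²-δ₁ (suc (suc zero))          = refl
mulV²-δ₁ (suc (suc (suc zero)))    = refl
mulV²-δ₁ (suc (suc (suc (suc i)))) = refl

mulPairs-mulV : ∀ a b j μ → mulPairs a b j (mulV μ) ≗ mulV (mulPairs a b j μ)
mulPairs-mulV a b j μ i =
  trans (mulPairs-mulX+ a b j 0ℚ (mulX+ 1ℚ μ) i) (cong-≗ (mulX+-linear 0ℚ) (mulPairs-mulX+ a b j 1ℚ μ) i)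

-- v h_k = (v − node k) h_k + node k h_k = h_{k+1} + node k h_k
mulV-mulH : ∀ k μ → mulV (mulH k μ) ≗ node k ·ᶠ mulH k μ +ᶠ mulH (suc k) μ
mulV-mulH k μ i = trans (split (ι k) (ν i) (ν (suc i)) (ν (suc (suc i))))
  (cong (λ t → node k * ν i + (t * (- ι k * ν i + ν (suc i)) + (- ι k * ν (suc i) + ν (suc (suc i))))) (sym (ι-suc k)))
  where
  ν = mulH k μ
  split : ∀ x a b c → 0ℚ * (1ℚ * a + b) + (1ℚ * b + c)
                      ≡ x * (x + 1ℚ + - 1ℚ + 1ℚ) * a + ((x + 1ℚ) * (- x * a + b) + (- x * b + c))
  split = solve-∀ ℚ-ring

mulV²-mulH : ∀ k μ → mulV (mulV (mulH k μ)) 0 ≡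
  node k * (node k * mulH k μ 0 + mulH (suc k) μ 0) + (node (suc k) * mulH (suc k) μ 0 + mulH (suc (suc k)) μ 0)
mulV²-mulH k μ = begin
  mulV (mulV (mulH k μ)) 0
    ≡⟨ cong-≗ mulV-linear (mulV-mulH k μ) 0 ⟩
  mulV (node k ·ᶠ mulH k μ +ᶠ mulH (suc k) μ) 0
    ≡⟨ +ᶠ-homo mulV-linear (node k ·ᶠ mulH k μ) (mulH (suc k) μ) 0 ⟩
  mulV (node k ·ᶠ mulH k μ) 0 + mulV (mulH (suc k) μ) 0
    ≡⟨ cong (_+ mulV (mulH (suc k) μ) 0) (·ᶠ-homo mulV-linear (node k) (mulH k μ) 0) ⟩
  node k * mulV (mulH k μ) 0 + mulV (mulH (suc k) μ) 0
    ≡⟨ cong₂ (λ s t → node k * s + t) (mulV-mulH k μ 0) (mulV-mulH (suc k) μ 0) ⟩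
  node k * (node k * mulH k μ 0 + mulH (suc k) μ 0) + (node (suc k) * mulH (suc k) μ 0 + mulH (suc (suc k)) μ 0) ∎
  where open ≡-Reasoning

-- Ψ(u² h_k(x + 1)) = (Ψ + δ₁)(v² h_k), and δ₁ kills the double root of v² at 0.
mulH⁺-mulU²-bernoulli : ∀ k → mulH⁺ k (mulU (mulU bernoulli)) 0 ≡ mulV (mulV (mulH k bernoulli)) 0
mulH⁺-mulU²-bernoulli k = begin
  mulH⁺ k (mulU (mulU bernoulli)) 0
    ≡⟨ sym (mulPairs-translate (λ j → ι (suc j)) (λ j → - ι j) k (mulU (mulU bernoulli)) 0) ⟩
  mulH k (translate (mulU (mulU bernoulli))) 0
    ≡⟨ cong-≗ (mulH-linear k) (λ i → trans (translate-mulU (mulU bernoulli) i) (cong-≗ mulV-linear (translate-mulU bernoulli) i)) 0 ⟩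
  mulH k (mulV (mulV (translate bernoulli))) 0
    ≡⟨ cong-≗ (mulH-linear k) (λ i → trans (cong-≗ V²-linear translate-bernoulli i) (+ᶠ-homo V²-linear bernoulli δ₁ i)) 0 ⟩
  mulH k (mulV (mulV bernoulli) +ᶠ mulV (mulV δ₁)) 0
    ≡⟨ +ᶠ-homo (mulH-linear k) (mulV (mulV bernoulli)) (mulV (mulV δ₁)) 0 ⟩
  mulH k (mulV (mulV bernoulli)) 0 + mulH k (mulV (mulV δ₁)) 0
    ≡⟨ cong (mulH k (mulV (mulV bernoulli)) 0 +_) (trans (cong-≗ (mulH-linear k) mulV²-δ₁ 0) (0ᶠ-homo (mulH-linear k) 0)) ⟩
  mulH k (mulV (mulV bernoulli)) 0 + 0ℚ
    ≡⟨ ℚP.+-identityʳ _ ⟩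
  mulH k (mulV (mulV bernoulli)) 0
    ≡⟨ mulPairs-mulV _ _ k (mulV bernoulli) 0 ⟩
  mulV (mulH k (mulV bernoulli)) 0
    ≡⟨ cong-≗ mulV-linear (mulPairs-mulV _ _ k bernoulli) 0 ⟩
  mulV (mulV (mulH k bernoulli)) 0 ∎
  where
  open ≡-Reasoning
  V²-linear : IsLinear (mulV ∘ mulV)
  V²-linear = ∘-linear mulV-linear mulV-linear

racahMoment-expansion : ∀ k → evalForm claimedMoment (racahFactorₙ k) ≡ (ℤ.+ 15 ℚ./ 2) * (sign k *
  (node k * (node k * bernoulliH k + bernoulliH (suc k)) + (node (suc k) * bernoulliH (suc k) + bernoulliH (suc (suc k)))))
racahMoment-expansion k = begin
  evalForm claimedMoment (racahFactorₙ k)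
    ≡⟨ trans (evalForm-cong claimedMoment≡ (racahFactorₙ k)) (evalForm-·ᶠ (ℤ.+ 15 ℚ./ 2) _ (racahFactorₙ k)) ⟩
  (ℤ.+ 15 ℚ./ 2) * evalForm (pushforward mulU (mulU (mulU bernoulli))) (racahFactorₙ k)
    ≡⟨ cong ((ℤ.+ 15 ℚ./ 2) *_) (evalForm-racahFactor k (mulU (mulU bernoulli))) ⟩
  (ℤ.+ 15 ℚ./ 2) * (sign k * mulH⁺ k (mulU (mulU bernoulli)) 0)
    ≡⟨ cong (λ t → (ℤ.+ 15 ℚ./ 2) * (sign k * t)) (trans (mulH⁺-mulU²-bernoulli k) (mulV²-mulH k bernoulli)) ⟩
  (ℤ.+ 15 ℚ./ 2) * (sign k * (node k * (node k * bernoulliH k + bernoulliH (suc k)) + (node (suc k) * bernoulliH (suc k) + bernoulliH (suc (suc k))))) ∎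
  where open ≡-Reasoning

sign²≡1 : ∀ k → sign k * sign k ≡ 1ℚ
sign²≡1 zero    = refl
sign²≡1 (suc k) = trans (neg*neg (sign k)) (sign²≡1 k)
  where
  neg*neg : ∀ s → - s * - s ≡ s * s
  neg*neg = solve-∀ ℚ-ring

-- Clearing the denominators 2x+1, 2x+3, 2x+5 of Ψ(h_k), Ψ(h_{k+1}), Ψ(h_{k+2}).
racahMoment-identity : ∀ x x₁ x₂ s f d₀ d₁ d₂ → x₁ ≡ x + 1ℚ → x₂ ≡ x₁ + 1ℚ → s * s ≡ 1ℚ →
  (x + x + 1ℚ) * d₀ ≡ s * (f * f) →
  (x₁ + x₁ + 1ℚ) * d₁ ≡ - s * (f * (1ℚ + x) * (f * (1ℚ + x))) →
  (x₂ + x₂ + 1ℚ) * d₂ ≡ - - s * (f * (1ℚ + x) * (1ℚ + x₁) * (f * (1ℚ + x) * (1ℚ + x₁))) →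
  (ℤ.+ 15 ℚ./ 2) * (s * (x * (x + 1ℚ + - 1ℚ + 1ℚ) * (x * (x + 1ℚ + - 1ℚ + 1ℚ) * d₀ + d₁)
                        + (x₁ * (x₁ + 1ℚ + - 1ℚ + 1ℚ) * d₁ + d₂)))
    * ((x + x + 1ℚ) * (x₁ + x₁ + 1ℚ) * (x₂ + x₂ + 1ℚ))
  ≡ ι 15 * (f * (1ℚ + x) * (f * (1ℚ + x)))
racahMoment-identity x _ _ s f d₀ d₁ d₂ refl refl s²≡1 h₀ h₁ h₂ = begin
  κ * (s * (n₀ * (n₀ * d₀ + d₁) + (n₁ * d₁ + d₂))) * (o₀ * o₁ * o₂)
    ≡⟨ separate κ s n₀ n₁ o₀ o₁ o₂ d₀ d₁ d₂ ⟩
  κ * s * (n₀ * n₀ * (o₁ * o₂) * (o₀ * d₀) + (n₀ + n₁) * (o₀ * o₂) * (o₁ * d₁) + o₀ * o₁ * (o₂ * d₂))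
    ≡⟨ cong₂ (λ u v → κ * s * (n₀ * n₀ * (o₁ * o₂) * u + (n₀ + n₁) * (o₀ * o₂) * v + o₀ * o₁ * (o₂ * d₂))) h₀ h₁ ⟩
  κ * s * (n₀ * n₀ * (o₁ * o₂) * (s * (f * f)) + (n₀ + n₁) * (o₀ * o₂) * (- s * (g * g)) + o₀ * o₁ * (o₂ * d₂))
    ≡⟨ cong (λ w → κ * s * (n₀ * n₀ * (o₁ * o₂) * (s * (f * f)) + (n₀ + n₁) * (o₀ * o₂) * (- s * (g * g)) + o₀ * o₁ * w)) h₂ ⟩
  κ * s * (n₀ * n₀ * (o₁ * o₂) * (s * (f * f)) + (n₀ + n₁) * (o₀ * o₂) * (- s * (g * g))
           + o₀ * o₁ * (- - s * (g * (1ℚ + (x + 1ℚ)) * (g * (1ℚ + (x + 1ℚ))))))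
    ≡⟨ combine x s f ⟩
  ι 15 * (s * s) * (g * g)
    ≡⟨ cong (λ t → ι 15 * t * (g * g)) s²≡1 ⟩
  ι 15 * 1ℚ * (g * g)
    ≡⟨ cong (_* (g * g)) (ℚP.*-identityʳ (ι 15)) ⟩
  ι 15 * (g * g) ∎
  where
  open ≡-Reasoning
  κ g n₀ n₁ o₀ o₁ o₂ : ℚ
  κ  = ℤ.+ 15 ℚ./ 2
  g  = f * (1ℚ + x)
  n₀ = x * (x + 1ℚ + - 1ℚ + 1ℚ)
  n₁ = (x + 1ℚ) * (x + 1ℚ + 1ℚ + - 1ℚ + 1ℚ)
  o₀ = x + x + 1ℚ
  o₁ = x + 1ℚ + (x + 1ℚ) + 1ℚ
  o₂ = x + 1ℚ + 1ℚ + (x + 1ℚ + 1ℚ) + 1ℚ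
  separate : ∀ κ s n₀ n₁ o₀ o₁ o₂ d₀ d₁ d₂ →
    κ * (s * (n₀ * (n₀ * d₀ + d₁) + (n₁ * d₁ + d₂))) * (o₀ * o₁ * o₂)
    ≡ κ * s * (n₀ * n₀ * (o₁ * o₂) * (o₀ * d₀) + (n₀ + n₁) * (o₀ * o₂) * (o₁ * d₁) + o₀ * o₁ * (o₂ * d₂))
  separate = solve-∀ ℚ-ring
  combine : ∀ x s f →
    (ℤ.+ 15 ℚ./ 2) * s *
      (x * (x + 1ℚ + - 1ℚ + 1ℚ) * (x * (x + 1ℚ + - 1ℚ + 1ℚ)) * ((x + 1ℚ + (x + 1ℚ) + 1ℚ) * (x + 1ℚ + 1ℚ + (x + 1ℚ + 1ℚ) + 1ℚ))
         * (s * (f * f))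
       + (x * (x + 1ℚ + - 1ℚ + 1ℚ) + (x + 1ℚ) * (x + 1ℚ + 1ℚ + - 1ℚ + 1ℚ)) * ((x + x + 1ℚ) * (x + 1ℚ + 1ℚ + (x + 1ℚ + 1ℚ) + 1ℚ))
         * (- s * (f * (1ℚ + x) * (f * (1ℚ + x))))
       + (x + x + 1ℚ) * (x + 1ℚ + (x + 1ℚ) + 1ℚ)
         * (- - s * (f * (1ℚ + x) * (1ℚ + (x + 1ℚ)) * (f * (1ℚ + x) * (1ℚ + (x + 1ℚ))))))
    ≡ ι 15 * (s * s) * (f * (1ℚ + x) * (f * (1ℚ + x)))
  combine = solve-∀ ℚ-ring

racahMoment-closed : ∀ k → evalForm claimedMoment (racahFactorₙ k) * (odd k * odd (suc k) * odd (suc (suc k)))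
                           ≡ ι 15 * (factorial (suc k) * factorial (suc k))
racahMoment-closed k = trans (cong (_* (odd k * odd (suc k) * odd (suc (suc k)))) (racahMoment-expansion k))
  (racahMoment-identity (ι k) (ι (suc k)) (ι (suc (suc k))) (sign k) (factorial k)
    (bernoulliH k) (bernoulliH (suc k)) (bernoulliH (suc (suc k))) (ι-suc k) (ι-suc (suc k)) (sign²≡1 k)
    (bernoulliH-closed k) (bernoulliH-closed (suc k)) (bernoulliH-closed (suc (suc k))))

-- Λ on the Racah polynomials

poch-suc : ∀ a k → poch a (suc k) ≡ a * poch (a + 1ℚ) k
poch-suc a zero    = unit a
  where
  unit : ∀ a → 1ℚ * (a + 0ℚ) ≡ a * 1ℚ
  unit = solve-∀ ℚ-ring
poch-suc a (suc k) = begin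
  poch a (suc k) * (a + ι (suc k))          ≡⟨ cong₂ (λ u v → u * (a + v)) (poch-suc a k) (ι-suc k) ⟩
  a * poch (a + 1ℚ) k * (a + (ι k + 1ℚ))    ≡⟨ regroup a (poch (a + 1ℚ) k) (ι k) ⟩
  a * (poch (a + 1ℚ) k * (a + 1ℚ + ι k))    ∎
  where
  open ≡-Reasoning
  regroup : ∀ a p x → a * p * (a + (x + 1ℚ)) ≡ a * (p * (a + 1ℚ + x))
  regroup = solve-∀ ℚ-ring

poch-vanishes : ∀ a n → a + ι n ≡ 0ℚ → poch a (suc n) ≡ 0ℚ
poch-vanishes a n a+n≡0 = trans (cong (poch a n *_) a+n≡0) (ℚP.*-zeroʳ (poch a n))

poch-pos : ∀ a → Positive a → ∀ k → Positive (poch a k)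
poch-pos a a>0 zero    = _
poch-pos a a>0 (suc k) =
  ℚP.pos*pos⇒pos (poch a k) {{poch-pos a a>0 k}} (a + ι k) {{ℚP.pos+nonNeg⇒pos a {{a>0}} (ι k) {{ι-nonNeg k}}}}

pochhammer-partialSum : ∀ a b c (t : ℕ → ℚ) → c ≡ a + b + 1ℚ →
  (∀ k → t k * (factorial k * poch c k) ≡ poch a k * poch b k) →
  ∀ K → sumTo (suc K) t * (factorial K * poch c K) ≡ poch (a + 1ℚ) K * poch (b + 1ℚ) K
pochhammer-partialSum a b _ t refl term zero    = trans (cong (_* (1ℚ * 1ℚ)) (ℚP.+-identityˡ (t 0))) (term 0)
pochhammer-partialSum a b c t refl term (suc K) = begin
  (S + t (suc K)) * (factorial K * (1ℚ + x) * (poch c K * (c + x)))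
    ≡⟨ distrib a b S (t (suc K)) (factorial K) (poch c K) x ⟩
  S * (factorial K * poch c K) * ((1ℚ + x) * (c + x)) + t (suc K) * (factorial (suc K) * poch c (suc K))
    ≡⟨ cong₂ (λ u v → u * ((1ℚ + x) * (c + x)) + v) (pochhammer-partialSum a b c t refl term K) (term (suc K)) ⟩
  A * B * ((1ℚ + x) * (c + x)) + poch a (suc K) * poch b (suc K)
    ≡⟨ cong₂ (λ u v → A * B * ((1ℚ + x) * (c + x)) + u * v) (poch-suc a K) (poch-suc b K) ⟩
  A * B * ((1ℚ + x) * (c + x)) + a * A * (b * B)
    ≡⟨ factor a b A B x ⟩
  A * (a + 1ℚ + x) * (B * (b + 1ℚ + x)) ∎
  where
  open ≡-Reasoning
  x = ι K
  S = sumTo (suc K) t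
  A = poch (a + 1ℚ) K
  B = poch (b + 1ℚ) K
  distrib : ∀ a b s u f p x → (s + u) * (f * (1ℚ + x) * (p * (a + b + 1ℚ + x)))
              ≡ s * (f * p) * ((1ℚ + x) * (a + b + 1ℚ + x)) + u * (f * (1ℚ + x) * (p * (a + b + 1ℚ + x)))
  distrib = solve-∀ ℚ-ring
  factor : ∀ a b p q x → p * q * ((1ℚ + x) * (a + b + 1ℚ + x)) + a * p * (b * q) ≡ p * (a + 1ℚ + x) * (q * (b + 1ℚ + x))
  factor = solve-∀ ℚ-ring

α : ℚ
α = - (ℤ.+ 1 ℚ./ 2)

racahCoeffₙ : ℕ → ℕ → ℚ
racahCoeffₙ = racahCoeff α (ι 2) 1ℚ (- 1ℚ)

racahNumerator : ℕ → ℕ → ℚ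
racahNumerator N k = poch (- ι N) k * poch (ι N + α + ι 2 + 1ℚ) k

racahDenominator : ℕ → ℚ
racahDenominator k = poch (α + 1ℚ) k * poch (ι 2 + - 1ℚ + 1ℚ) k * poch (1ℚ + 1ℚ) k * poch 1ℚ k

racahDenominator-pos : ∀ k → Positive (racahDenominator k)
racahDenominator-pos k =
  ℚP.pos*pos⇒pos (p₁ * p₂ * p₃) {{ℚP.pos*pos⇒pos (p₁ * p₂) {{ℚP.pos*pos⇒pos p₁ {{poch-pos (α + 1ℚ) _ k}} p₂ {{poch-pos (ι 2 + - 1ℚ + 1ℚ) _ k}}}}
                                     p₃ {{poch-pos (1ℚ + 1ℚ) _ k}}}}
                 (factorial k) {{poch-pos 1ℚ _ k}}
  where
  p₁ = poch (α + 1ℚ) k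
  p₂ = poch (ι 2 + - 1ℚ + 1ℚ) k
  p₃ = poch (1ℚ + 1ℚ) k

-- racahCoeff divides with the junk convention p ÷' 0 = 0; here the denominator is positive.
racahCoeffₙ*denominator : ∀ N k → racahCoeffₙ N k * racahDenominator k ≡ racahNumerator N k
racahCoeffₙ*denominator N k with racahDenominator k ℚ.≟ 0ℚ
... | yes den≡0 = ⊥-elim (pos⇒≢0 (racahDenominator-pos k) den≡0)
... | no  den≢0 = trans (ℚP.*-assoc (racahNumerator N k) _ (racahDenominator k))
  (trans (cong (racahNumerator N k *_) (ℚP.*-inverseˡ (racahDenominator k) {{ℚ.≢-nonZero den≢0}})) (ℚP.*-identityʳ _))

odd-suc : ∀ k → odd (suc k) ≡ odd k + ι 2
odd-suc k = trans (cong (λ t → t + t + 1ℚ) (ι-suc k)) (shift (ι k))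
  where
  shift : ∀ x → x + 1ℚ + (x + 1ℚ) + 1ℚ ≡ x + x + 1ℚ + ι 2
  shift = solve-∀ ℚ-ring

poch-½*odd³ : ∀ k → poch (α + 1ℚ) k * (odd k * odd (suc k) * odd (suc (suc k))) ≡ ι 15 * poch (ℤ.+ 7 ℚ./ 2) k
poch-½*odd³ zero    = refl
poch-½*odd³ (suc k) = begin
  poch (α + 1ℚ) k * (α + 1ℚ + ι k) * (odd (suc k) * odd (suc (suc k)) * odd (suc (suc (suc k))))
    ≡⟨ cong (λ t → poch (α + 1ℚ) k * (α + 1ℚ + ι k) * (odd (suc k) * odd (suc (suc k)) * t)) odd[3+k] ⟩
  poch (α + 1ℚ) k * (α + 1ℚ + ι k) * (odd (suc k) * odd (suc (suc k)) * (ι k + ι k + 1ℚ + ι 2 + ι 2 + ι 2))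
    ≡⟨ exchange (poch (α + 1ℚ) k) (odd (suc k)) (odd (suc (suc k))) (ι k) ⟩
  poch (α + 1ℚ) k * (odd k * odd (suc k) * odd (suc (suc k))) * (ℤ.+ 7 ℚ./ 2 + ι k)
    ≡⟨ cong (_* (ℤ.+ 7 ℚ./ 2 + ι k)) (poch-½*odd³ k) ⟩
  ι 15 * poch (ℤ.+ 7 ℚ./ 2) k * (ℤ.+ 7 ℚ./ 2 + ι k)
    ≡⟨ ℚP.*-assoc (ι 15) (poch (ℤ.+ 7 ℚ./ 2) k) (ℤ.+ 7 ℚ./ 2 + ι k) ⟩
  ι 15 * poch (ℤ.+ 7 ℚ./ 2) (suc k) ∎
  where
  open ≡-Reasoning
  odd[3+k] : odd (suc (suc (suc k))) ≡ ι k + ι k + 1ℚ + ι 2 + ι 2 + ι 2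
  odd[3+k] = trans (odd-suc (suc (suc k))) (cong (_+ ι 2) (trans (odd-suc (suc k)) (cong (_+ ι 2) (odd-suc k))))
  exchange : ∀ p o₁ o₂ x → p * (α + 1ℚ + x) * (o₁ * o₂ * (x + x + 1ℚ + ι 2 + ι 2 + ι 2))
                          ≡ p * ((x + x + 1ℚ) * o₁ * o₂) * (ℤ.+ 7 ℚ./ 2 + x)
  exchange = solve-∀ ℚ-ring

factorial-suc : ∀ k → factorial (suc k) ≡ poch (1ℚ + 1ℚ) k
factorial-suc k = trans (poch-suc 1ℚ k) (ℚP.*-identityˡ _)

racahTerm : ∀ N k → racahCoeffₙ N k * evalForm claimedMoment (racahFactorₙ k) * (factorial k * poch (ℤ.+ 7 ℚ./ 2) k)
                    ≡ racahNumerator N k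
racahTerm N k = *-cancelʳ 15f²≢0 (begin
  r * e * (f * p) * (ι 15 * (f′ * f′))               ≡⟨ regroup r e f p f′ ⟩
  r * e * f * f′ * f′ * (ι 15 * p)                   ≡⟨ cong (r * e * f * f′ * f′ *_) (sym (poch-½*odd³ k)) ⟩
  r * e * f * f′ * f′ * (h * q)                      ≡⟨ regroup′ r e f f′ h q ⟩
  r * (h * f′ * f′ * f) * (e * q)                    ≡⟨ cong₂ _*_ (trans (cong (r *_) den≡) (racahCoeffₙ*denominator N k)) (racahMoment-closed k) ⟩
  racahNumerator N k * (ι 15 * (f′ * f′))            ∎)
  where
  open ≡-Reasoning
  r = racahCoeffₙ N k
  e = evalForm claimedMoment (racahFactorₙ k)
  f = factorial k
  f′ = factorial (suc k)
  p = poch (ℤ.+ 7 ℚ./ 2) k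
  h = poch (α + 1ℚ) k
  q = odd k * odd (suc k) * odd (suc (suc k))
  den≡ : h * f′ * f′ * f ≡ racahDenominator k
  den≡ = cong₂ (λ u v → h * u * v * f) f′≡poch[2] (factorial-suc k)
    where
    f′≡poch[2] : f′ ≡ poch (ι 2 + - 1ℚ + 1ℚ) k
    f′≡poch[2] = factorial-suc k
  regroup : ∀ r e f p g → r * e * (f * p) * (ι 15 * (g * g)) ≡ r * e * f * g * g * (ι 15 * p)
  regroup = solve-∀ ℚ-ring
  regroup′ : ∀ r e f g h q → r * e * f * g * g * (h * q) ≡ r * (h * g * g * f) * (e * q)
  regroup′ = solve-∀ ℚ-ring
  15f²≢0 : ι 15 * (f′ * f′) ≢ 0ℚ
  15f²≢0 = *-≢0 {ι 15} (pos⇒≢0 (ι-pos 14)) (*-≢0 {f′} f′≢0 f′≢0)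
    where
    f′≢0 : f′ ≢ 0ℚ
    f′≢0 = pos⇒≢0 (poch-pos 1ℚ _ (suc k))

evalForm-racah : ∀ μ N → evalForm μ (Rₙ N) ≡ sumTo (suc N) (λ k → racahCoeffₙ N k * evalForm μ (racahFactorₙ k))
evalForm-racah μ N = trans (evalForm-psumTo μ (suc N) (λ k → pscale (racahCoeffₙ N k) (racahFactorₙ k)))
  (sumTo-cong (suc N) (λ k → evalForm-pscale μ (racahCoeffₙ N k) (racahFactorₙ k)))

claimedMoment-annihilates-racah : ∀ n → evalForm claimedMoment (Rₙ (suc n)) ≡ 0ℚ
claimedMoment-annihilates-racah n = trans (evalForm-racah claimedMoment N) (*-cancelʳ N!*P≢0 (begin
  sumTo (suc N) t * (factorial N * poch (ℤ.+ 7 ℚ./ 2) N)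
    ≡⟨ pochhammer-partialSum (- ι N) (ι N + α + ι 2 + 1ℚ) (ℤ.+ 7 ℚ./ 2) t (seven-halves (ι N)) (racahTerm N) N ⟩
  poch (- ι N + 1ℚ) N * poch (ι N + α + ι 2 + 1ℚ + 1ℚ) N
    ≡⟨ cong (_* poch (ι N + α + ι 2 + 1ℚ + 1ℚ) N) (poch-vanishes (- ι N + 1ℚ) n last-factor) ⟩
  0ℚ * poch (ι N + α + ι 2 + 1ℚ + 1ℚ) N
    ≡⟨ trans (ℚP.*-zeroˡ (poch (ι N + α + ι 2 + 1ℚ + 1ℚ) N)) (sym (ℚP.*-zeroˡ (factorial N * poch (ℤ.+ 7 ℚ./ 2) N))) ⟩
  0ℚ * (factorial N * poch (ℤ.+ 7 ℚ./ 2) N) ∎))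
  where
  open ≡-Reasoning
  N = suc n
  t : ℕ → ℚ
  t k = racahCoeffₙ N k * evalForm claimedMoment (racahFactorₙ k)
  seven-halves : ∀ x → ℤ.+ 7 ℚ./ 2 ≡ - x + (x + α + ι 2 + 1ℚ) + 1ℚ
  seven-halves = solve-∀ ℚ-ring
  cancel : ∀ x → - (x + 1ℚ) + 1ℚ + x ≡ 0ℚ
  cancel = solve-∀ ℚ-ring
  last-factor : - ι N + 1ℚ + ι n ≡ 0ℚ
  last-factor = trans (cong (λ s → - s + 1ℚ + ι n) (ι-suc n)) (cancel (ι n))
  N!*P≢0 : factorial N * poch (ℤ.+ 7 ℚ./ 2) N ≢ 0ℚ
  N!*P≢0 = *-≢0 {factorial N} (pos⇒≢0 (poch-pos 1ℚ _ N)) (pos⇒≢0 (poch-pos (ℤ.+ 7 ℚ./ 2) _ N))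

evalForm-racahFactor-triangular : ∀ k d → (∀ i → i ℕ.< k → d i ≡ 0ℚ) → evalForm d (racahFactorₙ k) ≡ sign k * d k
evalForm-racahFactor-triangular zero    d _     = evalForm-pconst d 1ℚ
evalForm-racahFactor-triangular (suc k) d below = begin
  evalForm d (pmul (racahFactorₙ k) (node k ∷ - 1ℚ ∷ []))
    ≡⟨ evalForm-pmul d (racahFactorₙ k) (node k ∷ - 1ℚ ∷ []) ⟩
  evalForm d′ (racahFactorₙ k)
    ≡⟨ evalForm-racahFactor-triangular k d′ below′ ⟩
  sign k * d′ k
    ≡⟨ cong (sign k *_) (trans (⋆-linear d (node k) (- 1ℚ) k) (cong (λ t → node k * t + - 1ℚ * d (suc k)) (below k (ℕP.n<1+n k)))) ⟩
  sign k * (node k * 0ℚ + - 1ℚ * d (suc k))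
    ≡⟨ simplify (sign k) (node k) (d (suc k)) ⟩
  - sign k * d (suc k) ∎
  where
  open ≡-Reasoning
  d′ = d ⋆ (node k ∷ - 1ℚ ∷ [])
  simplify : ∀ s c x → s * (c * 0ℚ + - 1ℚ * x) ≡ - s * x
  simplify = solve-∀ ℚ-ring
  vanish : ∀ c → c * 0ℚ + - 1ℚ * 0ℚ ≡ 0ℚ
  vanish = solve-∀ ℚ-ring
  below′ : ∀ i → i ℕ.< k → d′ i ≡ 0ℚ
  below′ i i<k = trans (⋆-linear d (node k) (- 1ℚ) i)
    (trans (cong₂ (λ u v → node k * u + - 1ℚ * v) (below i (ℕP.m<n⇒m<1+n i<k)) (below (suc i) (ℕ.s≤s i<k))) (vanish (node k)))

evalForm-racah-triangular : ∀ N d → (∀ i → i ℕ.< N → d i ≡ 0ℚ) → evalForm d (Rₙ N) ≡ racahCoeffₙ N N * (sign N * d N)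
evalForm-racah-triangular N d below = begin
  evalForm d (Rₙ N)
    ≡⟨ evalForm-racah d N ⟩
  sumTo N (λ k → racahCoeffₙ N k * evalForm d (racahFactorₙ k)) + racahCoeffₙ N N * evalForm d (racahFactorₙ N)
    ≡⟨ cong₂ _+_ (trans (sumTo-cong< N lower-vanish) (sumTo-0 N)) (cong (racahCoeffₙ N N *_) (evalForm-racahFactor-triangular N d below)) ⟩
  0ℚ + racahCoeffₙ N N * (sign N * d N)
    ≡⟨ ℚP.+-identityˡ _ ⟩
  racahCoeffₙ N N * (sign N * d N) ∎
  where
  open ≡-Reasoning
  lower-vanish : ∀ k → k ℕ.< N → racahCoeffₙ N k * evalForm d (racahFactorₙ k) ≡ 0ℚ
  lower-vanish k k<N = begin
    racahCoeffₙ N k * evalForm d (racahFactorₙ k)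
      ≡⟨ cong (racahCoeffₙ N k *_) (evalForm-racahFactor-triangular k d (λ i i<k → below i (ℕP.<-trans i<k k<N))) ⟩
    racahCoeffₙ N k * (sign k * d k)
      ≡⟨ cong (λ x → racahCoeffₙ N k * (sign k * x)) (below k k<N) ⟩
    racahCoeffₙ N k * (sign k * 0ℚ)
      ≡⟨ trans (cong (racahCoeffₙ N k *_) (ℚP.*-zeroʳ (sign k))) (ℚP.*-zeroʳ (racahCoeffₙ N k)) ⟩
    0ℚ ∎

sign≢0 : ∀ k → sign k ≢ 0ℚ
sign≢0 zero    ()
sign≢0 (suc k) -s≡0 = sign≢0 k (ℚP.neg-injective -s≡0)

ι-injective : ∀ {m n} → ι m ≡ ι n → m ≡ n
ι-injective {m} {n} eq = ℤP.+-injective (begin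
  ℤ.+ m                      ≡⟨ cong ℚᵘ.↥_ (toℚᵘ-ι m) ⟨
  ℚᵘ.↥ toℚᵘ (ι m)            ≡⟨ cong (ℚᵘ.↥_ ∘ toℚᵘ) eq ⟩
  ℚᵘ.↥ toℚᵘ (ι n)            ≡⟨ cong ℚᵘ.↥_ (toℚᵘ-ι n) ⟩
  ℤ.+ n                      ∎)
  where open ≡-Reasoning

poch≢0 : ∀ a k → (∀ i → i ℕ.< k → a + ι i ≢ 0ℚ) → poch a k ≢ 0ℚ
poch≢0 a zero    _        ()
poch≢0 a (suc k) factors≢0 =
  *-≢0 (poch≢0 a k (λ i i<k → factors≢0 i (ℕP.m<n⇒m<1+n i<k))) (factors≢0 k (ℕP.n<1+n k))

racahCoeffₙ-diagonal≢0 : ∀ N → racahCoeffₙ N N ≢ 0ℚ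
racahCoeffₙ-diagonal≢0 N r≡0 = *-≢0 (poch≢0 (- ι N) N −N+i≢0) (pos⇒≢0 (poch-pos (ι N + α + ι 2 + 1ℚ) N+5/2>0 N))
  (begin
    racahNumerator N N                       ≡⟨ racahCoeffₙ*denominator N N ⟨
    racahCoeffₙ N N * racahDenominator N     ≡⟨ cong (_* racahDenominator N) r≡0 ⟩
    0ℚ * racahDenominator N                  ≡⟨ ℚP.*-zeroˡ (racahDenominator N) ⟩
    0ℚ                                       ∎)
  where
  open ≡-Reasoning
  move : ∀ x y → - x + y ≡ 0ℚ → x ≡ y
  move x y eq = trans (solve x y) (trans (cong (λ z → y + - z) eq) (ℚP.+-identityʳ y))
    where
    solve : ∀ x y → x ≡ y + - (- x + y)
    solve = solve-∀ ℚ-ring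
  −N+i≢0 : ∀ i → i ℕ.< N → - ι N + ι i ≢ 0ℚ
  −N+i≢0 i i<N eq = ℕP.<⇒≢ i<N (sym (ι-injective (move (ι N) (ι i) eq)))
  rearrange : ∀ x → α + ι 2 + 1ℚ + x ≡ x + α + ι 2 + 1ℚ
  rearrange = solve-∀ ℚ-ring
  N+5/2>0 : Positive (ι N + α + ι 2 + 1ℚ)
  N+5/2>0 = subst Positive (rearrange (ι N)) (ℚP.pos+nonNeg⇒pos (α + ι 2 + 1ℚ) (ι N) {{ι-nonNeg N}})

≢0*≡0⇒≡0 : ∀ {a b} → a ≢ 0ℚ → a * b ≡ 0ℚ → b ≡ 0ℚ
≢0*≡0⇒≡0 {a} {b} a≢0 ab≡0 = *-cancelʳ a≢0 (trans (ℚP.*-comm b a) (trans ab≡0 (sym (ℚP.*-zeroˡ a))))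

racah-annihilator-vanishes : ∀ d → d 0 ≡ 0ℚ → (∀ n → evalForm d (Rₙ (suc n)) ≡ 0ℚ) → ∀ n → d n ≡ 0ℚ
racah-annihilator-vanishes d d₀≡0 annihilates = <-rec (λ n → d n ≡ 0ℚ) step
  where
  step : ∀ N → (∀ {i} → i ℕ.< N → d i ≡ 0ℚ) → d N ≡ 0ℚ
  step zero    _     = d₀≡0
  step (suc n) below = ≢0*≡0⇒≡0 (sign≢0 (suc n)) (≢0*≡0⇒≡0 (racahCoeffₙ-diagonal≢0 (suc n))
    (trans (sym (evalForm-racah-triangular (suc n) d (λ i → below))) (annihilates n)))

racah-moments-unique : ∀ μ ν → μ 0 ≡ ν 0 → (∀ n → evalForm μ (Rₙ (suc n)) ≡ evalForm ν (Rₙ (suc n))) → μ ≗ ν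
racah-moments-unique μ ν μ₀≡ν₀ agree n = difference-zero (μ n) (ν n) (racah-annihilator-vanishes d d₀≡0 annihilates n)
  where
  d : Form
  d = μ +ᶠ - 1ℚ ·ᶠ ν
  difference-zero : ∀ x y → x + - 1ℚ * y ≡ 0ℚ → x ≡ y
  difference-zero x y eq = trans (solve x y) (trans (cong (_+ y) eq) (ℚP.+-identityˡ y))
    where
    solve : ∀ x y → x ≡ (x + - 1ℚ * y) + y
    solve = solve-∀ ℚ-ring
  cancel : ∀ x → x + - 1ℚ * x ≡ 0ℚ
  cancel = solve-∀ ℚ-ring
  d₀≡0 : d 0 ≡ 0ℚ
  d₀≡0 = trans (cong (λ x → x + - 1ℚ * ν 0) μ₀≡ν₀) (cancel (ν 0))
  annihilates : ∀ n → evalForm d (Rₙ (suc n)) ≡ 0ℚ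
  annihilates n = begin
    evalForm d (Rₙ (suc n))
      ≡⟨ evalForm-+ᶠ μ (- 1ℚ ·ᶠ ν) (Rₙ (suc n)) ⟩
    evalForm μ (Rₙ (suc n)) + evalForm (- 1ℚ ·ᶠ ν) (Rₙ (suc n))
      ≡⟨ cong₂ _+_ (agree n) (evalForm-·ᶠ (- 1ℚ) ν (Rₙ (suc n))) ⟩
    evalForm ν (Rₙ (suc n)) + - 1ℚ * evalForm ν (Rₙ (suc n))
      ≡⟨ cancel (evalForm ν (Rₙ (suc n))) ⟩
    0ℚ ∎
    where open ≡-Reasoning

theorem2p4 : (m : ℕ → ℚ) →
    ((applyForm m (pconst 1ℚ) ≡ 1ℚ) × (∀ n → applyForm m (Rₙ (suc n)) ≡ 0ℚ))
      ⇔ (∀ n → m n ≡ claimedMoment n)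
theorem2p4 m = mk⇔ determined satisfies
  where
  applyForm-1 : ∀ μ → applyForm μ (pconst 1ℚ) ≡ 1ℚ * μ 0
  applyForm-1 μ = trans (applyForm≡evalForm μ (pconst 1ℚ)) (evalForm-pconst μ 1ℚ)
  determined : (applyForm m (pconst 1ℚ) ≡ 1ℚ) × (∀ n → applyForm m (Rₙ (suc n)) ≡ 0ℚ) → ∀ n → m n ≡ claimedMoment n
  determined (m-1 , m-R) = racah-moments-unique m claimedMoment
    (trans (sym (ℚP.*-identityˡ (m 0))) (trans (sym (applyForm-1 m)) m-1))
    (λ n → trans (sym (applyForm≡evalForm m (Rₙ (suc n)))) (trans (m-R n) (sym (claimedMoment-annihilates-racah n))))
  satisfies : (∀ n → m n ≡ claimedMoment n) → (applyForm m (pconst 1ℚ) ≡ 1ℚ) × (∀ n → applyForm m (Rₙ (suc n)) ≡ 0ℚ)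
  satisfies m≗ = trans (applyForm-1 m) (cong (1ℚ *_) (m≗ 0))
               , λ n → trans (applyForm≡evalForm m (Rₙ (suc n)))
                         (trans (evalForm-cong m≗ (Rₙ (suc n))) (claimedMoment-annihilates-racah n))
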